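{- Every evil-avoiding permutation $\pi$ can be written uniquely as a composition of maps in $\{\psi_p,\psi_q,\psi_r,\psi_s\}$ applied to $e_0$; that is, there is exactly one finite word $c_1\cdots c_m$ over $\{p,q,r,s\}$ such that, setting $\sigma_0=e_0$ and $\sigma_j=\psi_{c_{m-j+1}}(\sigma_{j-1})$ for $1\le j\le m$, each $\sigma_{j-1}$ lies in the domain of $\psi_{c_{m-j+1}}$, and $\sigma_m=\pi$.
   Context: Permutations are in one-line form $[\pi_1\cdots\pi_n]$; $S_0$ consists of the empty permutation $e_0$, and $e_n=[1\,2\cdots n]$. A permutation is evil-avoiding if it avoids each of the patterns $2413, 4132, 4213, 3214$. For $\pi\in S_n$, $1\le i,j\le n+1$, $\rho_{i,j}(\pi)\in S_{n+1}$ increases by $1$ every entry $\ge i$ and inserts the value $i$ at position $j$. $\mathbb{1}_S$ is $1$ if $S$ holds, else $0$. Operators: $\psi_p=\rho_{1,1}$, with domain the evil-avoiding permutations that are not an identity $e_n$ ($n\ge0$). $\psi_q$, with domain the evil-avoiding non-identity $\pi\in S_n$: let $t$ be the least $i$ such that $i$ occurs after $i+1$ in $\pi$. Call $\pi$ $(a,b)$-sandwiched ($a\ge0$, $b\ge1$ integers) if $\pi_i=i$ for $1\le i\le a$ and $\pi_{n-b+j}=a+j$ for $1\le j\le b$. If $\pi$ is $(a,b)$-sandwiched for some such $a,b$, then $\psi_q(\pi)=[a+b+1,1,2,\dots,a+1,\pi_{a+1}+1,\dots,\pi_{n-b}+1,a+2,\dots,a+b]$; otherwise $\psi_q(\pi)=\rho_{t+1,1}(\pi)=[t+1,\pi_1+\mathbb{1}_{\pi_1>t},\dots,\pi_n+\mathbb{1}_{\pi_n>t}]$.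 $\psi_r(\pi)=\rho_{1,n+1}(\pi)=[\pi_1+1,\dots,\pi_n+1,1]$, with domain the evil-avoiding $\pi\in S_n$, $n\ge1$. $\psi_s$, with domain $e_0$ together with the evil-avoiding $\pi\in S_n$ whose last $t$ entries are $1,2,\dots,t$ (in order) for some $t\ge1$: $\psi_s(\pi)=\rho_{t+1,n+1}(\pi)$, with $t=0$ for $e_0$ so that $\psi_s(e_0)=[1]$. -}

module Defs where

open import Data.Nat using (ℕ; zero; suc; _+_; _∸_; _≤_; _<_; _≤ᵇ_)
open import Data.Bool using (if_then_else_)
open import Data.Fin using (Fin) renaming (_<_ to _<ᶠ_)
open import Data.List using (List; []; _∷_; _++_; map; length; lookup; take; drop; upTo)
open import Data.List.Relation.Binary.Permutation.Propositional using (_↭_)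
open import Data.Product using (Σ; ∃; ∃-syntax; _×_)
open import Data.Sum using (_⊎_)
open import Relation.Nullary using (¬_)
open import Relation.Binary.PropositionalEquality using (_≡_; _≢_)

-- Permutations are lists in one-line form with values 1..n.

oneTo : ℕ → List ℕ
oneTo n = map suc (upTo n)

IsPerm : List ℕ → Set
IsPerm π = π ↭ oneTo (length π)

IsIdentity : List ℕ → Set
IsIdentity π = π ≡ oneTo (length π)

Contains : List ℕ → List ℕ → Set
Contains π τ =
  Σ (Fin (length τ) → Fin (length π)) λ f →
    (∀ a b → a <ᶠ b → f a <ᶠ f b) ×
    (∀ a b → (lookup τ a < lookup τ b → lookup π (f a) < lookup π (f b))
           × (lookup π (f a) < lookup π (f b) → lookup τ a < lookup τ b))

Avoids : List ℕ → List ℕ → Set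
Avoids π τ = ¬ Contains π τ

EvilAvoiding : List ℕ → Set
EvilAvoiding π =
  Avoids π (2 ∷ 4 ∷ 1 ∷ 3 ∷ []) × Avoids π (4 ∷ 1 ∷ 3 ∷ 2 ∷ []) ×
  Avoids π (4 ∷ 2 ∷ 1 ∷ 3 ∷ []) × Avoids π (3 ∷ 2 ∷ 1 ∷ 4 ∷ [])

EAPerm : List ℕ → Set
EAPerm π = IsPerm π × EvilAvoiding π

-- ρ_{i,j}: increase every entry ≥ i by one, insert value i at (1-based) position j
ρ : ℕ → ℕ → List ℕ → List ℕ
ρ i j π = take (j ∸ 1) π' ++ i ∷ drop (j ∸ 1) π'
  where
  π' = map (λ x → if i ≤ᵇ x then suc x else x) π

OccursAfter : List ℕ → ℕ → ℕ → Set
OccursAfter π x y = ∃[ pre ] ∃[ mid ] ∃[ post ] π ≡ pre ++ y ∷ mid ++ x ∷ post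

IsLeastDescentValue : List ℕ → ℕ → Set
IsLeastDescentValue π t =
  1 ≤ t × OccursAfter π t (suc t) ×
  (∀ i → 1 ≤ i → i < t → ¬ OccursAfter π i (suc i))

SandwichedWith : List ℕ → ℕ → ℕ → List ℕ → Set
SandwichedWith π a b mid = 1 ≤ b × π ≡ oneTo a ++ mid ++ map (a +_) (oneTo b)

Sandwiched : List ℕ → ℕ → ℕ → Set
Sandwiched π a b = ∃[ mid ] SandwichedWith π a b mid

data Letter : Set where
  p q r s : Letter

-- Step c σ τ : σ lies in the domain of ψ_c and ψ_c(σ) = τ
data Step : Letter → List ℕ → List ℕ → Set where
  step-p : ∀ {σ} → EAPerm σ → ¬ IsIdentity σ → Step p σ (ρ 1 1 σ)
  step-q-sand : ∀ {σ a b mid} → EAPerm σ → ¬ IsIdentity σ → SandwichedWith σ a b mid →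
    Step q σ ((a + b + 1) ∷ oneTo (a + 1) ++ map suc mid ++ map (suc a +_) (oneTo (b ∸ 1)))
  step-q-other : ∀ {σ t} → EAPerm σ → ¬ IsIdentity σ →
    (∀ a b → 1 ≤ b → ¬ Sandwiched σ a b) → IsLeastDescentValue σ t →
    Step q σ (ρ (suc t) 1 σ)
  step-r : ∀ {σ} → EAPerm σ → 1 ≤ length σ → Step r σ (ρ 1 (suc (length σ)) σ)
  step-s : ∀ {σ t pre} → EAPerm σ → σ ≡ pre ++ oneTo t → (1 ≤ t ⊎ σ ≡ []) →
    Step s σ (ρ (suc t) (suc (length σ)) σ)

-- Generates (c₁ ∷ ... ∷ cₘ) π : ψ_{c₁} ∘ ... ∘ ψ_{cₘ} applied to e_0 is defined
-- (each intermediate permutation in the relevant domain) and equals π.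
data Generates : List Letter → List ℕ → Set where
  gen-nil  : Generates [] []
  gen-cons : ∀ {c w σ τ} → Generates w σ → Step c σ τ → Generates (c ∷ w) τ

-- By induction on the length of π, both halves reduce to statements about the
-- last step ψ_c(σ) = π of a word producing π.
--
-- Uniqueness: the clause of ψ that produced π can be read off π itself.
-- ψp-images start with 1, ψr-images are longer than [1] and end with 1,
-- ψs-images are [1] or end with 1, …, t + 1 for some t ≥ 1, sandwiched
-- ψq-images are a + b + 1 followed by 1, …, a + 1, and the other ψq-images
-- start with t + 1 for the least descent value t of σ.  These shapes are
-- pairwise incompatible and each clause is injective.
--
-- Existence: an evil-avoiding π ≠ e₀ has one of these shapes, and deleting the
-- inserted value gives an evil-avoiding preimage.  The substantial case is the
-- one where π = v ∷ rest with v ≥ 2 and π does not end with an identity block: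
-- avoiding 3214, 4132 and 4213 then forces the values below v to appear in
-- increasing order, which pins down the ψq-preimage.
--
-- Pattern containment is handled as a sublist of four entries in one of the
-- evil relative orders (EvilFree below), which is equivalent to EvilAvoiding.

module Submission where

open import Defs
open import Function using (_∘_; id; case_of_)
open import Data.Nat
open import Data.Nat.Properties
open import Data.Bool using (true; false; if_then_else_)
open import Data.Unit using (tt)
open import Data.Fin using (Fin; zero; suc; toℕ; #_) renaming (_<_ to _<ᶠ_)
open import Data.Fin.Properties using (toℕ-injective)
open import Data.List using (List; []; _∷_; _++_; map; length; take; drop; applyUpTo; [_]; lookup; tabulate)
open import Data.List.Properties
open import Data.List.Membership.Propositional using (_∈_)
open import Data.List.Membership.Propositional.Properties
open import Data.List.Relation.Unary.Any using (here; there)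
open import Data.List.Relation.Unary.All as All using (All; []; _∷_)
import Data.List.Relation.Unary.All.Properties as AllP
open import Data.List.Relation.Unary.Unique.Propositional using (Unique)
open import Data.List.Relation.Unary.AllPairs using (AllPairs; []; _∷_)
import Data.List.Relation.Unary.AllPairs as AllPairs
import Data.List.Relation.Binary.Permutation.Propositional as P
open P using (_↭_; ↭-sym; ↭-trans; ↭-reflexive; ↭⇒↭ₛ)
import Data.List.Relation.Binary.Permutation.Propositional.Properties as PP
open import Data.Product using (Σ; ∃; ∃₂; _×_; _,_; proj₁; proj₂)
open import Data.Sum using (_⊎_; inj₁; inj₂)
open import Data.Empty
open import Data.List.Relation.Binary.Sublist.Propositional {A = ℕ} using (_⊆_; []; _∷_; _∷ʳ_; minimum; from∈; ⊆-refl; ⊆-trans)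
open import Data.List.Relation.Binary.Sublist.Propositional.Properties using (++⁺; ++⁺ˡ; ++⁺ʳ; map⁺; Any-resp-⊆; All-resp-⊆)
open import Relation.Nullary
open import Relation.Binary.Core using (_Preserves_⟶_)
open import Relation.Binary.Definitions using (tri<; tri≈; tri>)
open import Relation.Binary.PropositionalEquality hiding ([_])
open import Data.List.Relation.Binary.Permutation.Setoid.Properties (setoid ℕ) using (Unique-resp-↭)

interval : ℕ → ℕ → List ℕ
interval m zero = []
interval m (suc k) = suc m ∷ interval (suc m) k

map-suc-applyUpTo : ∀ (f : ℕ → ℕ) m k → (∀ i → f i ≡ m + i) → map suc (applyUpTo f k) ≡ interval m k
map-suc-applyUpTo f m zero h = refl
map-suc-applyUpTo f m (suc k) h = cong₂ _∷_ (cong suc (trans (h 0) (+-identityʳ m)))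
  (map-suc-applyUpTo (f ∘ suc) (suc m) k (λ i → trans (h (suc i)) (+-suc m i)))

oneTo≡interval : ∀ k → oneTo k ≡ interval 0 k
oneTo≡interval k = map-suc-applyUpTo id 0 k (λ i → refl)

map-+-interval : ∀ a m k → map (a +_) (interval m k) ≡ interval (a + m) k
map-+-interval a m zero = refl
map-+-interval a m (suc k) = cong₂ _∷_ (+-suc a m)
  (trans (map-+-interval a (suc m) k) (cong (λ z → interval z k) (+-suc a m)))

map-+-oneTo : ∀ a b → map (a +_) (oneTo b) ≡ interval a b
map-+-oneTo a b = trans (cong (map (a +_)) (oneTo≡interval b))
  (trans (map-+-interval a 0 b) (cong (λ z → interval z b) (+-identityʳ a)))

interval-++ : ∀ m j k → interval m (j + k) ≡ interval m j ++ interval (m + j) k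
interval-++ m zero k = cong (λ z → interval z k) (sym (+-identityʳ m))
interval-++ m (suc j) k = cong (suc m ∷_)
  (trans (interval-++ (suc m) j k) (cong (λ z → interval (suc m) j ++ interval z k) (sym (+-suc m j))))

interval-∷ʳ : ∀ m k → interval m (suc k) ≡ interval m k ++ [ suc (m + k) ]
interval-∷ʳ m zero = cong (λ z → [ suc z ]) (sym (+-identityʳ m))
interval-∷ʳ m (suc k) = cong (suc m ∷_)
  (trans (interval-∷ʳ (suc m) k) (cong (λ z → interval (suc m) k ++ [ suc z ]) (sym (+-suc m k))))

length-interval : ∀ m k → length (interval m k) ≡ k
length-interval m zero = refl
length-interval m (suc k) = cong suc (length-interval (suc m) k)

∈-interval⁻ : ∀ {x} m k → x ∈ interval m k → m < x × x ≤ m + k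
∈-interval⁻ m (suc k) (here refl) = ≤-refl , ≤-trans (s≤s (m≤m+n m k)) (≤-reflexive (sym (+-suc m k)))
∈-interval⁻ m (suc k) (there x∈) with ∈-interval⁻ (suc m) k x∈
... | a , b = <-trans (n<1+n m) a , ≤-trans b (≤-reflexive (sym (+-suc m k)))

∈-interval⁺ : ∀ {x} m k → m < x → x ≤ m + k → x ∈ interval m k
∈-interval⁺ {zero} m k () x≤
∈-interval⁺ {suc x} m zero m<x x≤ = ⊥-elim (<⇒≱ m<x (≤-trans x≤ (≤-reflexive (+-identityʳ m))))
∈-interval⁺ {suc x} m (suc k) m<x x≤ with x ≟ m
... | yes refl = here refl
... | no ne = there (∈-interval⁺ (suc m) k (s≤s (≤∧≢⇒< (≤-pred m<x) (ne ∘ sym))) (≤-trans x≤ (≤-reflexive (+-suc m k))))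

interval-increasing : ∀ m k → AllPairs _<_ (interval m k)
interval-increasing m zero = []
interval-increasing m (suc k) = All.tabulate (λ {x} h → proj₁ (∈-interval⁻ (suc m) k h)) ∷ interval-increasing (suc m) k

bump : ℕ → ℕ → ℕ
bump i x = if i ≤ᵇ x then suc x else x

unbump : ℕ → ℕ → ℕ
unbump k y = if suc k ≤ᵇ y then pred y else y

bump-≥ : ∀ {i x} → i ≤ x → bump i x ≡ suc x
bump-≥ {i} {x} h with i ≤ᵇ x | ≤⇒≤ᵇ h
... | true | _ = refl

bump-< : ∀ {i x} → x < i → bump i x ≡ x
bump-< {i} {x} h with i ≤ᵇ x | ≤ᵇ⇒≤ i x
... | false | _ = refl
... | true | f = ⊥-elim (<⇒≱ h (f tt))

unbump-> : ∀ {k y} → k < y → unbump k y ≡ pred y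
unbump-> {k} {y} h with suc k ≤ᵇ y | ≤⇒≤ᵇ h
... | true | _ = refl

unbump-≤ : ∀ {k y} → y ≤ k → unbump k y ≡ y
unbump-≤ {k} {y} h with suc k ≤ᵇ y | ≤ᵇ⇒≤ (suc k) y
... | false | _ = refl
... | true | f = ⊥-elim (<⇒≱ (f tt) h)

unbump-bump : ∀ k x → unbump k (bump k x) ≡ x
unbump-bump k x with k ≤? x
... | yes h = trans (cong (unbump k) (bump-≥ h)) (unbump-> (s≤s h))
... | no h = trans (cong (unbump k) (bump-< (≰⇒> h))) (unbump-≤ (<⇒≤ (≰⇒> h)))

bump-unbump : ∀ k y → y ≢ k → bump k (unbump k y) ≡ y
bump-unbump k y ne with k <? y
... | yes h = bump-unbump-> y h
  where bump-unbump-> : ∀ y → k < y → bump k (unbump k y) ≡ y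
        bump-unbump-> (suc y') h = trans (cong (bump k) (unbump-> h)) (bump-≥ (≤-pred h))
... | no h = trans (cong (bump k) (unbump-≤ (≮⇒≥ h))) (bump-< (≤∧≢⇒< (≮⇒≥ h) ne))

bump-injective : ∀ k {x y} → bump k x ≡ bump k y → x ≡ y
bump-injective k {x} {y} e = trans (sym (unbump-bump k x)) (trans (cong (unbump k) e) (unbump-bump k y))

bump-mono-< : ∀ k {x y} → x < y → bump k x < bump k y
bump-mono-< k {x} {y} h with k ≤? x | k ≤? y
... | yes a | yes b = subst₂ _<_ (sym (bump-≥ a)) (sym (bump-≥ b)) (s≤s h)
... | yes a | no b = ⊥-elim (b (≤-trans a (<⇒≤ h)))
... | no a | yes b = subst₂ _<_ (sym (bump-< (≰⇒> a))) (sym (bump-≥ b)) (m≤n⇒m≤1+n h)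
... | no a | no b = subst₂ _<_ (sym (bump-< (≰⇒> a))) (sym (bump-< (≰⇒> b))) h

bump-≢ : ∀ k x → bump k x ≢ k
bump-≢ k x e with k ≤? x
... | yes h = <⇒≱ (s≤s h) (≤-reflexive (trans (sym (bump-≥ h)) e))
... | no h = <⇒≢ (≰⇒> h) (trans (sym (bump-< (≰⇒> h))) e)

map-bump-< : ∀ k xs → All (_< k) xs → map (bump k) xs ≡ xs
map-bump-< k [] _ = refl
map-bump-< k (x ∷ xs) (h ∷ hs) = cong₂ _∷_ (bump-< h) (map-bump-< k xs hs)

map-bump-≥ : ∀ k xs → All (k ≤_) xs → map (bump k) xs ≡ map suc xs
map-bump-≥ k [] _ = refl
map-bump-≥ k (x ∷ xs) (h ∷ hs) = cong₂ _∷_ (bump-≥ h) (map-bump-≥ k xs hs)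

map-unbump-≤ : ∀ k xs → All (_≤ k) xs → map (unbump k) xs ≡ xs
map-unbump-≤ k [] _ = refl
map-unbump-≤ k (x ∷ xs) (h ∷ hs) = cong₂ _∷_ (unbump-≤ h) (map-unbump-≤ k xs hs)

map-unbump-bump : ∀ k xs → map (unbump k) (map (bump k) xs) ≡ xs
map-unbump-bump k [] = refl
map-unbump-bump k (x ∷ xs) = cong₂ _∷_ (unbump-bump k x) (map-unbump-bump k xs)

map-bump-unbump : ∀ k xs → All (_≢ k) xs → map (bump k) (map (unbump k) xs) ≡ xs
map-bump-unbump k [] _ = refl
map-bump-unbump k (x ∷ xs) (h ∷ hs) = cong₂ _∷_ (bump-unbump k x h) (map-bump-unbump k xs hs)

map-suc-pred : ∀ xs → All (1 ≤_) xs → map suc (map pred xs) ≡ xs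
map-suc-pred [] _ = refl
map-suc-pred (suc x ∷ xs) (h ∷ hs) = cong (suc x ∷_) (map-suc-pred xs hs)

ρ-at-end-map : ∀ (f : ℕ → ℕ) i σ → take (length σ) (map f σ) ++ i ∷ drop (length σ) (map f σ) ≡ map f σ ++ [ i ]
ρ-at-end-map f i [] = refl
ρ-at-end-map f i (x ∷ σ) = cong (f x ∷_) (ρ-at-end-map f i σ)

ρ-at-end : ∀ i σ → ρ i (suc (length σ)) σ ≡ map (bump i) σ ++ [ i ]
ρ-at-end i σ = ρ-at-end-map (bump i) i σ

IsPerm⇒↭interval : ∀ {π} → IsPerm π → π ↭ interval 0 (length π)
IsPerm⇒↭interval {π} h = ↭-trans h (↭-reflexive (oneTo≡interval (length π)))

IsPerm⇒Unique : ∀ {π} → IsPerm π → Unique π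
IsPerm⇒Unique h = Unique-resp-↭ (↭⇒↭ₛ (↭-sym (IsPerm⇒↭interval h))) (AllPairs.map <⇒≢ (interval-increasing 0 _))

IsPerm-∈⁻ : ∀ {π x} → IsPerm π → x ∈ π → 0 < x × x ≤ length π
IsPerm-∈⁻ {π} h m = ∈-interval⁻ 0 (length π) (PP.∈-resp-↭ (IsPerm⇒↭interval h) m)

IsPerm-∈⁺ : ∀ {π x} → IsPerm π → 0 < x → x ≤ length π → x ∈ π
IsPerm-∈⁺ {π} h a b = PP.∈-resp-↭ (↭-sym (IsPerm⇒↭interval h)) (∈-interval⁺ 0 (length π) a b)

IsPerm⇒positive : ∀ {π} → IsPerm π → All (0 <_) π
IsPerm⇒positive h = All.tabulate (λ m → proj₁ (IsPerm-∈⁻ h m))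

map-suc-interval : ∀ m k → map suc (interval m k) ≡ interval (suc m) k
map-suc-interval m k = map-+-interval 1 m k

interval↭bump-insert-+ : ∀ c d → interval 0 (suc (c + d)) ↭ suc c ∷ map (bump (suc c)) (interval 0 (c + d))
interval↭bump-insert-+ c d = ↭-trans (↭-reflexive e1) (↭-trans (PP.shift (suc c) (interval 0 c) (interval (suc c) d)) (↭-reflexive (cong (suc c ∷_) (sym e2))))
  where
  e1 : interval 0 (suc (c + d)) ≡ interval 0 c ++ suc c ∷ interval (suc c) d
  e1 = trans (cong (interval 0) (sym (+-suc c d))) (interval-++ 0 c (suc d))
  e2 : map (bump (suc c)) (interval 0 (c + d)) ≡ interval 0 c ++ interval (suc c) d
  e2 = trans (cong (map (bump (suc c))) (interval-++ 0 c d))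
       (trans (map-++ (bump (suc c)) (interval 0 c) (interval c d))
       (cong₂ _++_ (map-bump-< (suc c) (interval 0 c) (All.tabulate (λ m → s≤s (proj₂ (∈-interval⁻ 0 c m)))))
                   (trans (map-bump-≥ (suc c) (interval c d) (All.tabulate (λ m → proj₁ (∈-interval⁻ c d m)))) (map-suc-interval c d))))

interval↭bump-insert : ∀ c n → c ≤ n → interval 0 (suc n) ↭ suc c ∷ map (bump (suc c)) (interval 0 n)
interval↭bump-insert c n h = subst (λ z → interval 0 (suc z) ↭ suc c ∷ map (bump (suc c)) (interval 0 z)) (m+[n∸m]≡n h) (interval↭bump-insert-+ c (n ∸ c))

IsPerm-delete : ∀ k σ {π} → IsPerm π → π ↭ k ∷ map (bump k) σ → IsPerm σ
IsPerm-delete zero σ hπ h = ⊥-elim (<-irrefl refl (proj₁ (IsPerm-∈⁻ hπ (PP.∈-resp-↭ (↭-sym h) (here refl)))))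
IsPerm-delete (suc c) σ {π} hπ h = ↭-trans t3 (↭-reflexive (sym (oneTo≡interval n)))
  where
  n : ℕ
  n = length σ
  lenπ : length π ≡ suc n
  lenπ = trans (PP.↭-length h) (cong suc (length-map (bump (suc c)) σ))
  kle : suc c ≤ length π
  kle = proj₂ (IsPerm-∈⁻ hπ (PP.∈-resp-↭ (↭-sym h) (here refl)))
  hr : π ↭ interval 0 (suc n)
  hr = subst (λ z → π ↭ interval 0 z) lenπ (IsPerm⇒↭interval hπ)
  c≤n : c ≤ n
  c≤n = ≤-pred (≤-trans kle (≤-reflexive lenπ))
  t1 : suc c ∷ map (bump (suc c)) σ ↭ suc c ∷ map (bump (suc c)) (interval 0 n)
  t1 = ↭-trans (↭-sym h) (↭-trans hr (interval↭bump-insert c n c≤n))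
  t2 : map (unbump (suc c)) (map (bump (suc c)) σ) ↭ map (unbump (suc c)) (map (bump (suc c)) (interval 0 n))
  t2 = PP.map⁺ (unbump (suc c)) (PP.drop-∷ t1)
  t3 : σ ↭ interval 0 n
  t3 = subst₂ _↭_ (map-unbump-bump (suc c) σ) (map-unbump-bump (suc c) (interval 0 n)) t2

-- Pattern avoidance through sublists

⊆-++⁻ : ∀ {xs} ys {zs} → xs ⊆ (ys ++ zs) → ∃₂ λ xs1 xs2 → xs ≡ xs1 ++ xs2 × xs1 ⊆ ys × xs2 ⊆ zs
⊆-++⁻ [] h = [] , _ , refl , [] , h
⊆-++⁻ (y ∷ ys) (_ ∷ʳ h) with ⊆-++⁻ ys h
... | a , b , e , h1 , h2 = a , b , e , _ ∷ʳ h1 , h2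
⊆-++⁻ (y ∷ ys) (refl ∷ h) with ⊆-++⁻ ys h
... | a , b , e , h1 , h2 = y ∷ a , b , cong (y ∷_) e , refl ∷ h1 , h2

P2413 P4132 P4213 P3214 EvilPattern : ℕ → ℕ → ℕ → ℕ → Set
P2413 a b c d = c < a × a < d × d < b
P4132 a b c d = b < d × d < c × c < a
P4213 a b c d = c < b × b < d × d < a
P3214 a b c d = c < b × b < a × a < d
EvilPattern a b c d = P2413 a b c d ⊎ P4132 a b c d ⊎ P4213 a b c d ⊎ P3214 a b c d

EvilFree : List ℕ → Set
EvilFree π = ∀ {a b c d} → (a ∷ b ∷ c ∷ d ∷ []) ⊆ π → ¬ EvilPattern a b c d

EvilPattern-mono : ∀ g → g Preserves _<_ ⟶ _<_ → ∀ {a b c d} → EvilPattern a b c d → EvilPattern (g a) (g b) (g c) (g d)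
EvilPattern-mono g m (inj₁ (x , y , z)) = inj₁ (m x , m y , m z)
EvilPattern-mono g m (inj₂ (inj₁ (x , y , z))) = inj₂ (inj₁ (m x , m y , m z))
EvilPattern-mono g m (inj₂ (inj₂ (inj₁ (x , y , z)))) = inj₂ (inj₂ (inj₁ (m x , m y , m z)))
EvilPattern-mono g m (inj₂ (inj₂ (inj₂ (x , y , z)))) = inj₂ (inj₂ (inj₂ (m x , m y , m z)))

EvilFree-⊆ : ∀ {σ π} → σ ⊆ π → EvilFree π → EvilFree σ
EvilFree-⊆ σ⊆π e h = e (⊆-trans h σ⊆π)

EvilFree-map : ∀ g → g Preserves _<_ ⟶ _<_ → ∀ {σ π} → (map g σ) ⊆ π → EvilFree π → EvilFree σ
EvilFree-map g m sub e h b = e (⊆-trans (map⁺ g h) sub) (EvilPattern-mono g m b)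

⊆⇒embedding : ∀ {xs ys} → xs ⊆ ys → Σ (Fin (length xs) → Fin (length ys)) λ f →
  (∀ i j → i <ᶠ j → f i <ᶠ f j) × (∀ i → lookup ys (f i) ≡ lookup xs i)
⊆⇒embedding [] = (λ ()) , (λ ()) , (λ ())
⊆⇒embedding (_ ∷ʳ h) with ⊆⇒embedding h
... | f , f-mono , f-lookup = (λ i → suc (f i)) , (λ i j i<j → s≤s (f-mono i j i<j)) , f-lookup
⊆⇒embedding {x ∷ xs} {x ∷ ys} (refl ∷ h) with ⊆⇒embedding h
... | f , f-mono , f-lookup = g , g-mono , g-lookup
  where
  g : Fin (suc (length xs)) → Fin (suc (length ys))
  g zero = zero
  g (suc i) = suc (f i)
  g-mono : ∀ i j → i <ᶠ j → g i <ᶠ g j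
  g-mono zero (suc j) _ = s≤s z≤n
  g-mono (suc i) (suc j) i<j = s≤s (f-mono i j (≤-pred i<j))
  g-lookup : ∀ i → lookup (x ∷ ys) (g i) ≡ lookup (x ∷ xs) i
  g-lookup zero = refl
  g-lookup (suc i) = f-lookup i

pred-nonzero : ∀ {n} → (x : Fin (suc n)) → 0 < toℕ x → Fin n
pred-nonzero (suc x) _ = x

suc-pred-nonzero : ∀ {n} (x : Fin (suc n)) (h : 0 < toℕ x) → suc (pred-nonzero x h) ≡ x
suc-pred-nonzero (suc x) _ = refl

pred-nonzero-suc : ∀ {n} (x : Fin (suc n)) h {j} → x ≡ suc j → pred-nonzero x h ≡ j
pred-nonzero-suc (suc x) h refl = refl

embedding⇒⊆ : ∀ (ys : List ℕ) k (f : Fin k → Fin (length ys)) → (∀ i j → i <ᶠ j → f i <ᶠ f j) →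
  (tabulate (λ i → lookup ys (f i))) ⊆ ys
embedding⇒⊆ ys zero f m = minimum ys
embedding⇒⊆ [] (suc k) f m with f zero
... | ()
embedding⇒⊆ (y ∷ ys) (suc k) f m with f zero in eq
... | zero = refl ∷ rest
  where
  pos : ∀ i → 0 < toℕ (f (suc i))
  pos i = subst (λ u → toℕ u < toℕ (f (suc i))) eq (m zero (suc i) (s≤s z≤n))
  g : Fin k → Fin (length ys)
  g i = pred-nonzero (f (suc i)) (pos i)
  tg : ∀ i → toℕ (f (suc i)) ≡ suc (toℕ (g i))
  tg i = cong toℕ (sym (suc-pred-nonzero (f (suc i)) (pos i)))
  mg : ∀ i j → i <ᶠ j → g i <ᶠ g j
  mg i j lt = ≤-pred (subst₂ _<_ (tg i) (tg j) (m (suc i) (suc j) (s≤s lt)))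
  rest : (tabulate (λ i → lookup (y ∷ ys) (f (suc i)))) ⊆ ys
  rest = subst (_⊆ ys)
    (tabulate-cong (λ i → cong (lookup (y ∷ ys)) (suc-pred-nonzero (f (suc i)) (pos i))))
    (embedding⇒⊆ ys k g mg)
... | suc j = _ ∷ʳ (subst (_⊆ ys)
    (sym (cong₂ _∷_ (cong (lookup ys) (sym (pred-nonzero-suc (f zero) (pos zero) eq)))
      (tabulate-cong (λ i → cong (lookup (y ∷ ys)) (sym (suc-pred-nonzero (f (suc i)) (pos (suc i))))))))
    (embedding⇒⊆ ys (suc k) g mg))
  where
  pos : ∀ i → 0 < toℕ (f i)
  pos zero = subst (λ u → 0 < toℕ u) (sym eq) (s≤s z≤n)
  pos (suc i) = ≤-trans (s≤s z≤n) (m zero (suc i) (s≤s z≤n))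
  g : Fin (suc k) → Fin (length ys)
  g i = pred-nonzero (f i) (pos i)
  tg : ∀ i → toℕ (f i) ≡ suc (toℕ (g i))
  tg i = cong toℕ (sym (suc-pred-nonzero (f i) (pos i)))
  mg : ∀ i j → i <ᶠ j → g i <ᶠ g j
  mg i j lt = ≤-pred (subst₂ _<_ (tg i) (tg j) (m i j lt))

AllPairs-lookup : ∀ {R : ℕ → ℕ → Set} {xs} → AllPairs R xs →
  ∀ {i j : Fin (length xs)} → toℕ i < toℕ j → R (lookup xs i) (lookup xs j)
AllPairs-lookup (rx ∷ _) {zero} {suc j} _ = All.lookup rx (∈-lookup j)
AllPairs-lookup (_ ∷ rs) {suc i} {suc j} i<j = AllPairs-lookup rs (≤-pred i<j)

increasing-lookup⁻ : ∀ {xs} → AllPairs _<_ xs →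
  ∀ {i j : Fin (length xs)} → lookup xs i < lookup xs j → toℕ i < toℕ j
increasing-lookup⁻ {xs} inc {i} {j} lookup< with <-cmp (toℕ i) (toℕ j)
... | tri< i<j _ _ = i<j
... | tri≈ _ i≡j _ = ⊥-elim (<-irrefl (cong (lookup xs) (toℕ-injective i≡j)) lookup<)
... | tri> _ _ j<i = ⊥-elim (<-asym lookup< (AllPairs-lookup inc j<i))

increasing⁴ : ∀ {w₀ w₁ w₂ w₃} → w₀ < w₁ → w₁ < w₂ → w₂ < w₃ → AllPairs _<_ (w₀ ∷ w₁ ∷ w₂ ∷ w₃ ∷ [])
increasing⁴ w₀<w₁ w₁<w₂ w₂<w₃ =
  (w₀<w₁ ∷ <-trans w₀<w₁ w₁<w₂ ∷ <-trans w₀<w₁ (<-trans w₁<w₂ w₂<w₃) ∷ []) ∷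
  (w₁<w₂ ∷ <-trans w₁<w₂ w₂<w₃ ∷ []) ∷ (w₂<w₃ ∷ []) ∷ [] ∷ []

Fin4-cases : ∀ {P : Fin 4 → Set} → P (# 0) → P (# 1) → P (# 2) → P (# 3) → ∀ i → P i
Fin4-cases p₀ _ _ _ zero = p₀
Fin4-cases _ p₁ _ _ (suc zero) = p₁
Fin4-cases _ _ p₂ _ (suc (suc zero)) = p₂
Fin4-cases _ _ _ p₃ (suc (suc (suc zero))) = p₃

⊆⇒Contains : ∀ {π t₀ t₁ t₂ t₃ a b c d w₀ w₁ w₂ w₃} (rank : Fin 4 → Fin 4) →
  AllPairs _<_ (w₀ ∷ w₁ ∷ w₂ ∷ w₃ ∷ []) →
  (∀ i → lookup (t₀ ∷ t₁ ∷ t₂ ∷ t₃ ∷ []) i ≡ suc (toℕ (rank i))) →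
  (∀ i → lookup (a ∷ b ∷ c ∷ d ∷ []) i ≡ lookup (w₀ ∷ w₁ ∷ w₂ ∷ w₃ ∷ []) (rank i)) →
  (a ∷ b ∷ c ∷ d ∷ []) ⊆ π → Contains π (t₀ ∷ t₁ ∷ t₂ ∷ t₃ ∷ [])
⊆⇒Contains {π} {t₀} {t₁} {t₂} {t₃} {w₀ = w₀} {w₁} {w₂} {w₃} rank ws-increasing τ≡rank abcd≡ws abcd⊆
  with ⊆⇒embedding abcd⊆
... | f , f-mono , f-lookup = f , f-mono , order
  where
  τ ws : List ℕ
  τ = t₀ ∷ t₁ ∷ t₂ ∷ t₃ ∷ []
  ws = w₀ ∷ w₁ ∷ w₂ ∷ w₃ ∷ []
  π≡ws : ∀ i → lookup π (f i) ≡ lookup ws (rank i)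
  π≡ws i = trans (f-lookup i) (abcd≡ws i)
  order : ∀ i j → (lookup τ i < lookup τ j → lookup π (f i) < lookup π (f j)) ×
                  (lookup π (f i) < lookup π (f j) → lookup τ i < lookup τ j)
  order i j =
    (λ τi<τj → subst₂ _<_ (sym (π≡ws i)) (sym (π≡ws j))
                 (AllPairs-lookup ws-increasing (≤-pred (subst₂ _<_ (τ≡rank i) (τ≡rank j) τi<τj)))) ,
    (λ πi<πj → subst₂ _<_ (sym (τ≡rank i)) (sym (τ≡rank j))
                 (s≤s (increasing-lookup⁻ ws-increasing (subst₂ _<_ (π≡ws i) (π≡ws j) πi<πj))))

EvilAvoiding⇒EvilFree : ∀ {π} → EvilAvoiding π → EvilFree π
EvilAvoiding⇒EvilFree (¬2413 , ¬4132 , ¬4213 , ¬3214) abcd⊆ (inj₁ (c<a , a<d , d<b)) =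
  ¬2413 (⊆⇒Contains (lookup (# 1 ∷ # 3 ∷ # 0 ∷ # 2 ∷ [])) (increasing⁴ c<a a<d d<b)
           (Fin4-cases refl refl refl refl) (Fin4-cases refl refl refl refl) abcd⊆)
EvilAvoiding⇒EvilFree (¬2413 , ¬4132 , ¬4213 , ¬3214) abcd⊆ (inj₂ (inj₁ (b<d , d<c , c<a))) =
  ¬4132 (⊆⇒Contains (lookup (# 3 ∷ # 0 ∷ # 2 ∷ # 1 ∷ [])) (increasing⁴ b<d d<c c<a)
           (Fin4-cases refl refl refl refl) (Fin4-cases refl refl refl refl) abcd⊆)
EvilAvoiding⇒EvilFree (¬2413 , ¬4132 , ¬4213 , ¬3214) abcd⊆ (inj₂ (inj₂ (inj₁ (c<b , b<d , d<a)))) =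
  ¬4213 (⊆⇒Contains (lookup (# 3 ∷ # 1 ∷ # 0 ∷ # 2 ∷ [])) (increasing⁴ c<b b<d d<a)
           (Fin4-cases refl refl refl refl) (Fin4-cases refl refl refl refl) abcd⊆)
EvilAvoiding⇒EvilFree (¬2413 , ¬4132 , ¬4213 , ¬3214) abcd⊆ (inj₂ (inj₂ (inj₂ (c<b , b<a , a<d)))) =
  ¬3214 (⊆⇒Contains (lookup (# 2 ∷ # 1 ∷ # 0 ∷ # 3 ∷ [])) (increasing⁴ c<b b<a a<d)
           (Fin4-cases refl refl refl refl) (Fin4-cases refl refl refl refl) abcd⊆)

EvilFree⇒EvilAvoiding : ∀ {π} → EvilFree π → EvilAvoiding π
EvilFree⇒EvilAvoiding {π} evil-free = ¬2413 , ¬4132 , ¬4213 , ¬3214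
  where
  ¬2413 : Avoids π (2 ∷ 4 ∷ 1 ∷ 3 ∷ [])
  ¬2413 (f , f-mono , order) = evil-free (embedding⇒⊆ π 4 f f-mono)
    (inj₁ (proj₁ (order (# 2) (# 0)) ≤-refl , proj₁ (order (# 0) (# 3)) ≤-refl , proj₁ (order (# 3) (# 1)) ≤-refl))
  ¬4132 : Avoids π (4 ∷ 1 ∷ 3 ∷ 2 ∷ [])
  ¬4132 (f , f-mono , order) = evil-free (embedding⇒⊆ π 4 f f-mono)
    (inj₂ (inj₁ (proj₁ (order (# 1) (# 3)) ≤-refl , proj₁ (order (# 3) (# 2)) ≤-refl , proj₁ (order (# 2) (# 0)) ≤-refl)))
  ¬4213 : Avoids π (4 ∷ 2 ∷ 1 ∷ 3 ∷ [])
  ¬4213 (f , f-mono , order) = evil-free (embedding⇒⊆ π 4 f f-mono)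
    (inj₂ (inj₂ (inj₁ (proj₁ (order (# 2) (# 1)) ≤-refl , proj₁ (order (# 1) (# 3)) ≤-refl , proj₁ (order (# 3) (# 0)) ≤-refl))))
  ¬3214 : Avoids π (3 ∷ 2 ∷ 1 ∷ 4 ∷ [])
  ¬3214 (f , f-mono , order) = evil-free (embedding⇒⊆ π 4 f f-mono)
    (inj₂ (inj₂ (inj₂ (proj₁ (order (# 2) (# 1)) ≤-refl , proj₁ (order (# 1) (# 0)) ≤-refl , proj₁ (order (# 0) (# 3)) ≤-refl))))

⊆-Unique-head : ∀ {L x xs} → Unique L → (x ∷ xs) ⊆ L → x ∈ xs → ⊥
⊆-Unique-head (a ∷ u) (_ ∷ʳ h) m = ⊆-Unique-head u h m
⊆-Unique-head (a ∷ u) (refl ∷ h) m = All.lookup a (Any-resp-⊆ h m) refl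

⊆-glue : ∀ {L} → Unique L → ∀ xs {b ys} → (xs ++ [ b ]) ⊆ L → (b ∷ ys) ⊆ L → (xs ++ b ∷ ys) ⊆ L
⊆-glue {y ∷ L} (ay ∷ u) [] S1 (refl ∷ S2) = refl ∷ S2
⊆-glue {y ∷ L} (ay ∷ u) [] (refl ∷ S1) (_ ∷ʳ S2) = ⊥-elim (All.lookup ay (Any-resp-⊆ S2 (here refl)) refl)
⊆-glue {y ∷ L} (ay ∷ u) [] (_ ∷ʳ S1) (_ ∷ʳ S2) = _ ∷ʳ (⊆-glue u [] S1 S2)
⊆-glue {y ∷ L} (ay ∷ u) (x ∷ xs) (refl ∷ S1) (refl ∷ S2) = ⊥-elim (All.lookup ay (Any-resp-⊆ S1 (∈-++⁺ʳ xs (here refl))) refl)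
⊆-glue {y ∷ L} (ay ∷ u) (x ∷ xs) (_ ∷ʳ S1) (refl ∷ S2) = ⊥-elim (All.lookup ay (Any-resp-⊆ S1 (there (∈-++⁺ʳ xs (here refl)))) refl)
⊆-glue {y ∷ L} (ay ∷ u) (x ∷ xs) (refl ∷ S1) (_ ∷ʳ S2) = refl ∷ (⊆-glue u xs S1 S2)
⊆-glue {y ∷ L} (ay ∷ u) (x ∷ xs) (_ ∷ʳ S1) (_ ∷ʳ S2) = _ ∷ʳ (⊆-glue u (x ∷ xs) S1 S2)

⊆-pair-antisym : ∀ {L a b} → Unique L → (a ∷ b ∷ []) ⊆ L → (b ∷ a ∷ []) ⊆ L → ⊥
⊆-pair-antisym u h1 h2 = ⊆-Unique-head u (⊆-glue u (_ ∷ []) h1 h2) (there (here refl))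

⊆-pair-irrefl : ∀ {L a} → Unique L → (a ∷ a ∷ []) ⊆ L → ⊥
⊆-pair-irrefl u h = ⊆-Unique-head u h (here refl)

OccursAfter⇒⊆ : ∀ {L x y} → OccursAfter L x y → (y ∷ x ∷ []) ⊆ L
OccursAfter⇒⊆ {x = x} {y} (pre , mid , post , refl) = ++⁺ˡ pre (refl ∷ (++⁺ˡ mid (refl ∷ (minimum post))))

⊆⇒OccursAfter : ∀ {L x y} → (y ∷ x ∷ []) ⊆ L → OccursAfter L x y
⊆⇒OccursAfter (z ∷ʳ h) with ⊆⇒OccursAfter h
... | pre , mid , post , e = z ∷ pre , mid , post , cong (z ∷_) e
⊆⇒OccursAfter (refl ∷ h) with ∈-∃++ (Any-resp-⊆ h (here refl))
... | mid , post , e = [] , mid , post , cong (_ ∷_) e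

Unique-∷-split : ∀ {x : ℕ} (A B C D : List ℕ) → Unique (A ++ x ∷ B) → A ++ x ∷ B ≡ C ++ x ∷ D → A ≡ C × B ≡ D
Unique-∷-split [] B [] D u e = refl , ∷-injectiveʳ e
Unique-∷-split [] B (c ∷ C) D (a ∷ u) e with ∷-injective e
... | refl , e2 = ⊥-elim (All.lookup a (subst (_ ∈_) (sym e2) (∈-++⁺ʳ C (here refl))) refl)
Unique-∷-split (a ∷ A) B [] D (ax ∷ u) e with ∷-injective e
... | refl , e2 = ⊥-elim (All.lookup ax (∈-++⁺ʳ A (here refl)) refl)
Unique-∷-split (a ∷ A) B (c ∷ C) D (_ ∷ u) e with ∷-injective e
... | refl , e2 with Unique-∷-split A B C D u e2
... | refl , refl = refl , refl

Unique-++-disjoint : ∀ {x : ℕ} (A : List ℕ) {B} → Unique (A ++ B) → x ∈ A → x ∈ B → ⊥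
Unique-++-disjoint (a ∷ A) (ax ∷ u) (here refl) mb = All.lookup ax (∈-++⁺ʳ A mb) refl
Unique-++-disjoint (a ∷ A) (_ ∷ u) (there ma) mb = Unique-++-disjoint A u ma mb

AllPairs-⊆ : ∀ {R : ℕ → ℕ → Set} {xs ys} → xs ⊆ ys → AllPairs R ys → AllPairs R xs
AllPairs-⊆ [] ps = ps
AllPairs-⊆ (_ ∷ʳ h) (_ ∷ ps) = AllPairs-⊆ h ps
AllPairs-⊆ (refl ∷ h) (a ∷ ps) = All-resp-⊆ h a ∷ AllPairs-⊆ h ps

increasing-pair : ∀ {T a b} → AllPairs _<_ T → (a ∷ b ∷ []) ⊆ T → a < b
increasing-pair i h with AllPairs-⊆ h i
... | (a<b ∷ []) ∷ _ = a<b

increasing-from-pairs : ∀ {T} → (∀ {a b} → (a ∷ b ∷ []) ⊆ T → a < b) → AllPairs _<_ T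
increasing-from-pairs {[]} h = []
increasing-from-pairs {x ∷ T} h = All.tabulate (λ m → h (refl ∷ (from∈ m))) ∷ increasing-from-pairs (λ sub → h (_ ∷ʳ sub))

increasing-unless-inverted : ∀ {T} → Unique T → (∀ {a b} → b < a → (a ∷ b ∷ []) ⊆ T → ⊥) → AllPairs _<_ T
increasing-unless-inverted {T} uT inverted = increasing-from-pairs pair<
  where
  pair< : ∀ {a b} → (a ∷ b ∷ []) ⊆ T → a < b
  pair< {a} {b} ab⊆ with <-cmp a b
  ... | tri< a<b _ _ = a<b
  ... | tri≈ _ refl _ = ⊥-elim (⊆-pair-irrefl uT ab⊆)
  ... | tri> _ _ b<a = ⊥-elim (inverted b<a ab⊆)

increasing≡interval : ∀ {T} m k → AllPairs _<_ T → (∀ {u} → u ∈ T → m < u × u ≤ m + k) → (∀ {u} → m < u → u ≤ m + k → u ∈ T) → T ≡ interval m k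
increasing≡interval {[]} m zero i h1 h2 = refl
increasing≡interval {[]} m (suc k) i h1 h2 with h2 {suc m} ≤-refl (≤-trans (s≤s (m≤m+n m k)) (≤-reflexive (sym (+-suc m k))))
... | ()
increasing≡interval {x ∷ T} m zero i h1 h2 = ⊥-elim (<⇒≱ (proj₁ (h1 (here refl))) (≤-trans (proj₂ (h1 (here refl))) (≤-reflexive (+-identityʳ m))))
increasing≡interval {x ∷ T} m (suc k) (a ∷ i) h1 h2 = cong₂ _∷_ xe (increasing≡interval (suc m) k i g1 g2)
  where
  xe : x ≡ suc m
  xe with h2 {suc m} ≤-refl (≤-trans (s≤s (m≤m+n m k)) (≤-reflexive (sym (+-suc m k))))
  ... | here e = sym e
  ... | there mm = ⊥-elim (<⇒≱ (All.lookup a mm) (proj₁ (h1 (here refl))))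
  g1 : ∀ {u} → u ∈ T → suc m < u × u ≤ suc m + k
  g1 mm = subst (_< _) xe (All.lookup a mm) , ≤-trans (proj₂ (h1 (there mm))) (≤-reflexive (+-suc m k))
  g2 : ∀ {u} → suc m < u → u ≤ suc m + k → u ∈ T
  g2 {u} p1 p2 with h2 {u} (<-trans (n<1+n m) p1) (≤-trans p2 (≤-reflexive (sym (+-suc m k))))
  ... | here e = ⊥-elim (<-irrefl (sym (trans e xe)) p1)
  ... | there mm = mm

⊆-map⁻ : ∀ (f : ℕ → ℕ) {xs L} → xs ⊆ (map f L) → ∃ λ xs' → xs' ⊆ L × map f xs' ≡ xs
⊆-map⁻ f {L = []} [] = [] , [] , refl
⊆-map⁻ f {L = y ∷ L} (_ ∷ʳ h) with ⊆-map⁻ f h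
... | xs' , sub , e = xs' , _ ∷ʳ sub , e
⊆-map⁻ f {L = y ∷ L} (refl ∷ h) with ⊆-map⁻ f h
... | xs' , sub , e = y ∷ xs' , refl ∷ sub , cong (f y ∷_) e

map≡++⁻ : ∀ (f : ℕ → ℕ) {L} A B → map f L ≡ A ++ B → ∃₂ λ A' B' → L ≡ A' ++ B' × map f A' ≡ A × map f B' ≡ B
map≡++⁻ f {L} [] B e = [] , L , refl , refl , e
map≡++⁻ f {y ∷ L} (a ∷ A) B e with ∷-injective e
... | e1 , e2 with map≡++⁻ f A B e2
... | A' , B' , e3 , e4 , e5 = y ∷ A' , B' , cong (y ∷_) e3 , cong₂ _∷_ e1 e4 , e5

map≡∷ʳ⁻ : ∀ (f : ℕ → ℕ) {L} A c → map f L ≡ A ++ [ c ] → ∃₂ λ A' c' → L ≡ A' ++ [ c' ] × map f A' ≡ A × f c' ≡ c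
map≡∷ʳ⁻ f A c e with map≡++⁻ f A [ c ] e
... | A' , (c' ∷ []) , e3 , e4 , e5 = A' , c' , e3 , e4 , ∷-injectiveˡ e5

-- Uniqueness of the last step

ψq-sandwiched : ℕ → ℕ → List ℕ → List ℕ
ψq-sandwiched a b mid = (a + b + 1) ∷ oneTo (a + 1) ++ map suc mid ++ map (suc a +_) (oneTo (b ∸ 1))

data StepShape : Letter → List ℕ → List ℕ → Set where
  shape-p : ∀ {σ π} → EAPerm σ → ¬ IsIdentity σ → π ≡ 1 ∷ map suc σ → StepShape p σ π
  shape-q-sand : ∀ {σ π a b mid} → EAPerm σ → ¬ IsIdentity σ → SandwichedWith σ a b mid → π ≡ ψq-sandwiched a b mid → StepShape q σ π
  shape-q-other : ∀ {σ π t} → EAPerm σ → ¬ IsIdentity σ → (∀ a b → 1 ≤ b → ¬ Sandwiched σ a b) →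
        IsLeastDescentValue σ t → π ≡ suc t ∷ map (bump (suc t)) σ → StepShape q σ π
  shape-r : ∀ {σ π} → EAPerm σ → 1 ≤ length σ → π ≡ map suc σ ++ [ 1 ] → StepShape r σ π
  shape-s : ∀ {σ π t pre} → EAPerm σ → σ ≡ pre ++ oneTo t → (1 ≤ t ⊎ σ ≡ []) →
       π ≡ map (bump (suc t)) σ ++ [ suc t ] → StepShape s σ π

map-bump-1 : ∀ {σ} → EAPerm σ → map (bump 1) σ ≡ map suc σ
map-bump-1 {σ} h = map-bump-≥ 1 σ (IsPerm⇒positive (proj₁ h))

stepShape : ∀ {c σ π} → Step c σ π → StepShape c σ π
stepShape (step-p h ni) = shape-p h ni (cong (1 ∷_) (map-bump-1 h))
stepShape (step-q-sand h ni sw) = shape-q-sand h ni sw refl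
stepShape (step-q-other h ni ns ld) = shape-q-other h ni ns ld refl
stepShape {σ = σ} (step-r h l) = shape-r h l (trans (ρ-at-end 1 σ) (cong (_++ [ 1 ]) (map-bump-1 h)))
stepShape {σ = σ} (step-s {t = t} h e d) = shape-s h e d (ρ-at-end (suc t) σ)

bump≡1 : ∀ {k y} → 2 ≤ k → bump k y ≡ 1 → y ≡ 1
bump≡1 {k} {y} h e with k ≤? y
... | yes g = ⊥-elim (absurd y g (suc-injective (trans (sym (bump-≥ g)) e)))
  where absurd : ∀ y → k ≤ y → y ≡ 0 → ⊥
        absurd .0 g refl = <⇒≱ (≤-trans (s≤s z≤n) h) g
... | no g = trans (sym (bump-< (≰⇒> g))) e

SandwichedWith⇒intervals : ∀ {σ a b mid} → SandwichedWith σ a b mid → σ ≡ interval 0 a ++ mid ++ interval a b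
SandwichedWith⇒intervals {a = a} {b} {mid} (_ , e) = trans e (cong₂ (λ u v → u ++ mid ++ v) (oneTo≡interval a) (map-+-oneTo a b))

ψq-sandwiched-intervals : ∀ a b mid → ψq-sandwiched a (suc b) mid ≡ suc (a + suc b) ∷ interval 0 (suc a) ++ map suc mid ++ interval (suc a) b
ψq-sandwiched-intervals a b mid = cong₂ _∷_ (+-comm (a + suc b) 1)
  (cong₂ (λ u v → u ++ map suc mid ++ v) (trans (cong oneTo (+-comm a 1)) (oneTo≡interval (suc a))) (map-+-oneTo (suc a) b))

IsIdentity⇒interval : ∀ {σ} → IsIdentity σ → σ ≡ interval 0 (length σ)
IsIdentity⇒interval {σ} e = trans e (oneTo≡interval (length σ))

interval-IsIdentity : ∀ k → IsIdentity (interval 0 k)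
interval-IsIdentity k = trans (sym (oneTo≡interval k)) (cong oneTo (sym (length-interval 0 k)))

sandwich-middle-nonempty : ∀ {σ a b mid} → ¬ IsIdentity σ → SandwichedWith σ a b mid → mid ≢ []
sandwich-middle-nonempty {σ} {a} {b} {mid} ni sw refl = ni (subst IsIdentity (sym (trans (SandwichedWith⇒intervals {σ} {a} {b} {[]} sw) (sym (interval-++ 0 a b)))) (interval-IsIdentity (a + b)))

sandwich-middle-head : ∀ {σ a b m ms} → IsPerm σ → SandwichedWith σ a b (m ∷ ms) → m ≢ suc a
sandwich-middle-head {σ} {a} {suc b} {m} {ms} hp sw refl =
  Unique-++-disjoint (interval 0 a ++ [ suc a ]) (subst Unique e (IsPerm⇒Unique hp)) (∈-++⁺ʳ (interval 0 a) (here refl)) (∈-++⁺ʳ ms (here refl))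
  where
  e : σ ≡ (interval 0 a ++ [ suc a ]) ++ ms ++ interval a (suc b)
  e = trans (SandwichedWith⇒intervals {σ} {a} {suc b} {suc a ∷ ms} sw) (sym (++-assoc (interval 0 a) [ suc a ] _))
sandwich-middle-head {b = zero} hp (() , _)

≢[]⇒∷ʳ : ∀ (xs : List ℕ) → xs ≢ [] → ∃₂ λ ys y → xs ≡ ys ++ [ y ]
≢[]⇒∷ʳ [] ne = ⊥-elim (ne refl)
≢[]⇒∷ʳ (x ∷ []) ne = [] , x , refl
≢[]⇒∷ʳ (x ∷ x' ∷ xs) ne with ≢[]⇒∷ʳ (x' ∷ xs) (λ ())
... | ys , y , e = x ∷ ys , y , cong (x ∷_) e

head-interval : ∀ {m X c n} → m ∷ X ≡ interval c n → m ≡ suc c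
head-interval {n = zero} ()
head-interval {n = suc n} e = ∷-injectiveˡ e

interval-prefix : ∀ m j n R → interval m j ++ R ≡ interval m n → R ≡ interval (m + j) (n ∸ j)
interval-prefix m zero n R e = trans e (cong (λ z → interval z n) (sym (+-identityʳ m)))
interval-prefix m (suc j) zero R ()
interval-prefix m (suc j) (suc n) R e = trans (interval-prefix (suc m) j n R (∷-injectiveʳ e)) (cong (λ z → interval z (n ∸ j)) (sym (+-suc m j)))

ψs-image-ends-interval : ∀ {σ t pre} → σ ≡ pre ++ oneTo t → 1 ≤ t → map (bump (suc t)) σ ++ [ suc t ] ≡ map (bump (suc t)) pre ++ interval 0 (suc t)
ψs-image-ends-interval {σ} {t} {pre} e h = begin
  map (bump (suc t)) σ ++ [ suc t ] ≡⟨ cong (λ u → map (bump (suc t)) u ++ [ suc t ]) (trans e (cong (pre ++_) (oneTo≡interval t))) ⟩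
  map (bump (suc t)) (pre ++ interval 0 t) ++ [ suc t ] ≡⟨ cong (_++ [ suc t ]) (map-++ (bump (suc t)) pre (interval 0 t)) ⟩
  (map (bump (suc t)) pre ++ map (bump (suc t)) (interval 0 t)) ++ [ suc t ] ≡⟨ cong (λ u → (map (bump (suc t)) pre ++ u) ++ [ suc t ]) (map-bump-< (suc t) (interval 0 t) (All.tabulate (λ mm → s≤s (proj₂ (∈-interval⁻ 0 t mm))))) ⟩
  (map (bump (suc t)) pre ++ interval 0 t) ++ [ suc t ] ≡⟨ ++-assoc (map (bump (suc t)) pre) (interval 0 t) [ suc t ] ⟩
  map (bump (suc t)) pre ++ interval 0 t ++ [ suc t ] ≡⟨ cong (map (bump (suc t)) pre ++_) (sym (interval-∷ʳ 0 t)) ⟩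
  map (bump (suc t)) pre ++ interval 0 (suc t) ∎
  where open ≡-Reasoning

ψs-domain-[] : ∀ {σ t pre} → σ ≡ pre ++ oneTo t → σ ≡ [] → t ≡ 0
ψs-domain-[] {t = zero} e e' = refl
ψs-domain-[] {t = suc t} {[]} e e' with trans (sym e) e'
... | ()
ψs-domain-[] {t = suc t} {x ∷ pre} e e' with trans (sym e) e'
... | ()

map≡[] : ∀ (f : ℕ → ℕ) {xs} → map f xs ≡ [] → xs ≡ []
map≡[] f {[]} _ = refl
map≡[] f {x ∷ xs} ()

Unique-head∉ : ∀ {y : ℕ} {xs} → Unique (y ∷ xs) → y ∈ xs → ⊥
Unique-head∉ (a ∷ _) m = All.lookup a m refl

1∈interval : ∀ t → 1 ≤ t → 1 ∈ interval 0 t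
1∈interval (suc t) _ = here refl

p-image≢q-sandwiched-image : ∀ {X a b mid} → 1 ≤ b → 1 ∷ X ≡ ψq-sandwiched a b mid → ⊥
p-image≢q-sandwiched-image {a = a} {b} h e = <⇒≢ h (sym (m+n≡0⇒n≡0 a (sym (suc-injective (trans (∷-injectiveˡ e) (+-comm (a + b) 1))))))

p-image≢q-other-image : ∀ {X Y t} → 1 ≤ t → 1 ∷ X ≡ suc t ∷ Y → ⊥
p-image≢q-other-image h e = <⇒≢ h (suc-injective (∷-injectiveˡ e))

p-image≢r-image : ∀ {X σ'} → EAPerm σ' → 1 ≤ length σ' → 1 ∷ X ≡ map suc σ' ++ [ 1 ] → ⊥
p-image≢r-image {σ' = y ∷ σ'} h l e with IsPerm⇒positive (proj₁ h)
... | py ∷ _ = <⇒≢ py (suc-injective (∷-injectiveˡ e))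

p-image≢s-image : ∀ {σ σs t pre} → ¬ IsIdentity σ → EAPerm σs → σs ≡ pre ++ oneTo t → (1 ≤ t ⊎ σs ≡ []) →
  1 ∷ map suc σ ≡ map (bump (suc t)) σs ++ [ suc t ] → ⊥
p-image≢s-image {σ} {t = t} {pre} ni hs eq (inj₂ refl) e with ψs-domain-[] {[]} {t} {pre} eq refl
... | refl = ni (subst IsIdentity (sym (map≡[] suc (∷-injectiveʳ e))) refl)
p-image≢s-image {σ} {σs} {t} {[]} ni hs eq (inj₁ h) e =
  ni (subst IsIdentity (sym σe) (interval-IsIdentity t))
  where
  e' : 1 ∷ map suc σ ≡ interval 0 (suc t)
  e' = trans e (ψs-image-ends-interval eq h)
  σe : σ ≡ interval 0 t
  σe = map-injective suc-injective (trans (∷-injectiveʳ e') (sym (map-suc-interval 0 t)))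
p-image≢s-image {σ} {σs} {t} {y ∷ pre} ni hs eq (inj₁ h) e =
  Unique-head∉ (subst Unique (trans eq (cong (_∷ _) y1)) (IsPerm⇒Unique (proj₁ hs)))
    (∈-++⁺ʳ pre (subst (1 ∈_) (sym (oneTo≡interval t)) (1∈interval t h)))
  where
  e' : 1 ∷ map suc σ ≡ map (bump (suc t)) (y ∷ pre) ++ interval 0 (suc t)
  e' = trans e (ψs-image-ends-interval eq h)
  y1 : y ≡ 1
  y1 = bump≡1 (s≤s h) (sym (∷-injectiveˡ e'))

∷-++-∷ʳ-assoc : ∀ (h : ℕ) A B C (z : ℕ) → h ∷ A ++ B ++ (C ++ [ z ]) ≡ (h ∷ A ++ B ++ C) ++ [ z ]
∷-++-∷ʳ-assoc h A B C z = cong (h ∷_) (trans (cong (A ++_) (sym (++-assoc B C [ z ]))) (sym (++-assoc A (B ++ C) [ z ])))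

q-sandwiched-image≢r-image : ∀ {σ1 σ2 a b mid} → EAPerm σ1 → ¬ IsIdentity σ1 → SandwichedWith σ1 a b mid →
  ψq-sandwiched a b mid ≡ map suc σ2 ++ [ 1 ] → ⊥
q-sandwiched-image≢r-image {σ1} {σ2} {a} {suc (suc b)} {mid} h1 ni sw e = 1+n≢0 (suc-injective (∷ʳ-injectiveʳ (suc (a + suc (suc b)) ∷ interval 0 (suc a) ++ map suc mid ++ interval (suc a) b) (map suc σ2) e'))
  where
  e' : (suc (a + suc (suc b)) ∷ interval 0 (suc a) ++ map suc mid ++ interval (suc a) b) ++ [ suc (suc a + b) ] ≡ map suc σ2 ++ [ 1 ]
  e' = trans (sym (∷-++-∷ʳ-assoc (suc (a + suc (suc b))) (interval 0 (suc a)) (map suc mid) (interval (suc a) b) (suc (suc a + b))))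
        (trans (cong (λ u → suc (a + suc (suc b)) ∷ interval 0 (suc a) ++ map suc mid ++ u) (sym (interval-∷ʳ (suc a) b)))
          (trans (sym (ψq-sandwiched-intervals a (suc b) mid)) e))
q-sandwiched-image≢r-image {σ1} {σ2} {a} {suc zero} {mid} h1 ni sw e with ≢[]⇒∷ʳ mid (sandwich-middle-nonempty {σ1} {a} {1} {mid} ni sw)
... | mid0 , m , refl = <⇒≢ (All.lookup (IsPerm⇒positive (proj₁ h1)) mσ) (sym (suc-injective (∷ʳ-injectiveʳ (suc (a + 1) ∷ interval 0 (suc a) ++ map suc mid0) (map suc σ2) e')))
  where
  mσ : m ∈ σ1
  mσ = subst (m ∈_) (sym (SandwichedWith⇒intervals {σ1} {a} {1} {mid0 ++ [ m ]} sw)) (∈-++⁺ʳ (interval 0 a) (∈-++⁺ˡ (∈-++⁺ʳ mid0 (here refl))))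
  e' : (suc (a + 1) ∷ interval 0 (suc a) ++ map suc mid0) ++ [ suc m ] ≡ map suc σ2 ++ [ 1 ]
  e' = trans (sym (∷-++-∷ʳ-assoc (suc (a + 1)) (interval 0 (suc a)) [] (map suc mid0) (suc m)))
        (trans (cong (λ u → suc (a + 1) ∷ interval 0 (suc a) ++ u) (trans (sym (map-++ suc mid0 [ m ])) (sym (++-identityʳ _))))
          (trans (sym (ψq-sandwiched-intervals a 0 (mid0 ++ [ m ]))) e))
q-sandwiched-image≢r-image {b = zero} h1 ni (() , _) e

-- Comparing first entries gives t = a + b; undoing the shift then shows
-- σ2 = 1, …, a + 1, mid′, a + 2, …, a + b.  For b ≥ 2 this makes σ2 sandwiched;
-- for b = 1 the value t = a + 1 ends the prefix, so t + 1 cannot occur before it.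
q-sandwiched-image≢q-other-image : ∀ {σ1 σ2 a b mid t} → EAPerm σ1 → ¬ IsIdentity σ1 → SandwichedWith σ1 a b mid →
  EAPerm σ2 → (∀ a b → 1 ≤ b → ¬ Sandwiched σ2 a b) → IsLeastDescentValue σ2 t →
  ψq-sandwiched a b mid ≡ suc t ∷ map (bump (suc t)) σ2 → ⊥
q-sandwiched-image≢q-other-image {b = zero} h1 ni (() , _) h2 ns ld e
q-sandwiched-image≢q-other-image {σ1} {σ2} {a} {suc b} {mid} {t} h1 ni sw h2 ns ld e with suc-injective (∷-injectiveˡ (trans (sym (ψq-sandwiched-intervals a b mid)) e))
... | refl = refute b refl
  where
  top : ℕ
  top = a + suc b
  e1 : suc top ∷ interval 0 (suc a) ++ map suc mid ++ interval (suc a) b ≡ suc top ∷ map (bump (suc top)) σ2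
  e1 = trans (sym (ψq-sandwiched-intervals a b mid)) e
  tl : interval 0 (suc a) ++ map suc mid ++ interval (suc a) b ≡ map (bump (suc top)) σ2
  tl = ∷-injectiveʳ e1
  M' : List ℕ
  M' = map (unbump (suc top)) (map suc mid)
  aT : a ≤ top
  aT = m≤m+n a (suc b)
  σe : σ2 ≡ interval 0 (suc a) ++ M' ++ interval (suc a) b
  σe = begin
    σ2 ≡⟨ sym (map-unbump-bump (suc top) σ2) ⟩
    map (unbump (suc top)) (map (bump (suc top)) σ2) ≡⟨ cong (map (unbump (suc top))) (sym tl) ⟩
    map (unbump (suc top)) (interval 0 (suc a) ++ map suc mid ++ interval (suc a) b) ≡⟨ map-++ (unbump (suc top)) (interval 0 (suc a)) _ ⟩
    map (unbump (suc top)) (interval 0 (suc a)) ++ map (unbump (suc top)) (map suc mid ++ interval (suc a) b) ≡⟨ cong (map (unbump (suc top)) (interval 0 (suc a)) ++_) (map-++ (unbump (suc top)) (map suc mid) _) ⟩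
    map (unbump (suc top)) (interval 0 (suc a)) ++ M' ++ map (unbump (suc top)) (interval (suc a) b) ≡⟨ cong₂ (λ u v → u ++ M' ++ v)
        (map-unbump-≤ (suc top) (interval 0 (suc a)) (All.tabulate (λ mm → ≤-trans (proj₂ (∈-interval⁻ 0 (suc a) mm)) (s≤s aT))))
        (map-unbump-≤ (suc top) (interval (suc a) b) (All.tabulate (λ mm → ≤-trans (proj₂ (∈-interval⁻ (suc a) b mm)) (s≤s (+-monoʳ-≤ a (n≤1+n b)))))) ⟩
    interval 0 (suc a) ++ M' ++ interval (suc a) b ∎
    where open ≡-Reasoning
  refute : ∀ b' → b' ≡ b → ⊥
  refute (suc b'') refl = ns (suc a) (suc b'') (s≤s z≤n)
    (M' , s≤s z≤n , trans σe (cong₂ (λ u v → u ++ M' ++ v) (sym (oneTo≡interval (suc a))) (sym (map-+-oneTo (suc a) (suc b'')))))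
  refute zero refl with proj₁ (proj₂ ld)
  ... | pre , md , post , oe = <⇒≱ (s≤s (m≤m+n a 1)) (proj₂ (∈-interval⁻ 0 a inr))
    where
    Ta : top ≡ suc a
    Ta = +-comm a 1
    u2 : Unique (interval 0 a ++ suc a ∷ (M' ++ []))
    u2 = subst Unique (trans σe (trans (cong (_++ M' ++ []) (interval-∷ʳ 0 a)) (++-assoc (interval 0 a) [ suc a ] (M' ++ [])))) (IsPerm⇒Unique (proj₁ h2))
    oe2 : interval 0 a ++ suc a ∷ (M' ++ []) ≡ (pre ++ suc top ∷ md) ++ suc a ∷ post
    oe2 = trans (trans (sym (++-assoc (interval 0 a) [ suc a ] (M' ++ []))) (trans (cong (_++ M' ++ []) (sym (interval-∷ʳ 0 a))) (sym σe)))
          (trans oe (trans (cong (λ z → pre ++ suc top ∷ md ++ z ∷ post) Ta) (sym (++-assoc pre (suc top ∷ md) (suc a ∷ post)))))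
    inr : suc top ∈ interval 0 a
    inr = subst (suc top ∈_) (sym (proj₁ (Unique-∷-split (interval 0 a) (M' ++ []) (pre ++ suc top ∷ md) post u2 oe2))) (∈-++⁺ʳ pre (here refl))

q-sandwiched-image≢s-image : ∀ {σ1 σs a b mid t pre} → EAPerm σ1 → ¬ IsIdentity σ1 → SandwichedWith σ1 a b mid →
  EAPerm σs → σs ≡ pre ++ oneTo t → (1 ≤ t ⊎ σs ≡ []) →
  ψq-sandwiched a b mid ≡ map (bump (suc t)) σs ++ [ suc t ] → ⊥
q-sandwiched-image≢s-image {b = zero} h1 ni (() , _) hs eq d e
q-sandwiched-image≢s-image {σ1} {σs} {a} {suc b} {mid} {t} {pre} h1 ni sw hs eq (inj₂ refl) e with ψs-domain-[] {[]} {t} {pre} eq refl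
... | refl with ∷-injectiveʳ (trans (sym (ψq-sandwiched-intervals a b mid)) e)
... | ()
q-sandwiched-image≢s-image {σ1} {σs} {a} {suc b} {mid} {t} {[]} h1 ni sw hs eq (inj₁ h) e =
  1+n≢0 (m+n≡0⇒n≡0 a (suc-injective (∷-injectiveˡ (trans (trans (sym (ψq-sandwiched-intervals a b mid)) e) (ψs-image-ends-interval eq h)))))
q-sandwiched-image≢s-image {σ1} {σs} {a} {suc b} {[]} {t} {y ∷ []} h1 ni sw hs eq (inj₁ h) e = sandwich-middle-nonempty {σ1} {a} {suc b} {[]} ni sw refl
q-sandwiched-image≢s-image {σ1} {σs} {a} {suc b} {m ∷ ms} {t} {y ∷ []} h1 ni sw hs eq (inj₁ h) e =
  sandwich-middle-head (proj₁ h1) sw (suc-injective (head-interval (interval-prefix 0 (suc a) (suc t) _ (∷-injectiveʳ (trans (trans (sym (ψq-sandwiched-intervals a b (m ∷ ms))) e) (ψs-image-ends-interval eq h))))))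
q-sandwiched-image≢s-image {σ1} {σs} {a} {suc b} {mid} {t} {y ∷ y' ∷ pre} h1 ni sw hs eq (inj₁ h) e =
  Unique-head∉ (subst Unique (cong (_∷ _) y1) u1) (∈-++⁺ʳ pre (subst (1 ∈_) (sym (oneTo≡interval t)) (1∈interval t h)))
  where
  e2 : interval 0 (suc a) ++ map suc mid ++ interval (suc a) b ≡ map (bump (suc t)) (y' ∷ pre) ++ interval 0 (suc t)
  e2 = ∷-injectiveʳ (trans (trans (sym (ψq-sandwiched-intervals a b mid)) e) (ψs-image-ends-interval eq h))
  y1 : y' ≡ 1
  y1 = bump≡1 (s≤s h) (sym (∷-injectiveˡ e2))
  u1 : Unique (y' ∷ pre ++ oneTo t)
  u1 with subst Unique eq (IsPerm⇒Unique (proj₁ hs))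
  ... | _ ∷ u = u

q-other-image≢r-image : ∀ {σ1 σ2 t} → (∀ a b → 1 ≤ b → ¬ Sandwiched σ1 a b) → IsLeastDescentValue σ1 t →
  1 ≤ length σ2 → suc t ∷ map (bump (suc t)) σ1 ≡ map suc σ2 ++ [ 1 ] → ⊥
q-other-image≢r-image {σ1} {y ∷ σ2} {t} ns ld l e with map≡∷ʳ⁻ (bump (suc t)) (map suc σ2) 1 (∷-injectiveʳ e)
... | A' , c' , eσ , _ , ec = ns 0 1 (s≤s z≤n) (A' , s≤s z≤n , trans eσ (cong (λ z → A' ++ [ z ]) (bump≡1 (s≤s (proj₁ ld)) ec)))

q-other-image≢s-image : ∀ {σ1 σs t t' pre} → ¬ IsIdentity σ1 → (∀ a b → 1 ≤ b → ¬ Sandwiched σ1 a b) → IsLeastDescentValue σ1 t →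
  σs ≡ pre ++ oneTo t' → (1 ≤ t' ⊎ σs ≡ []) →
  suc t ∷ map (bump (suc t)) σ1 ≡ map (bump (suc t')) σs ++ [ suc t' ] → ⊥
q-other-image≢s-image {σ1} {t' = t'} {pre} ni ns ld eq (inj₂ refl) e with ψs-domain-[] {[]} {t'} {pre} eq refl
... | refl = ni (subst IsIdentity (sym (map≡[] _ (∷-injectiveʳ e))) refl)
q-other-image≢s-image {σ1} {σs} {t} {t'} {[]} ni ns ld eq (inj₁ h) e =
  <⇒≢ (proj₁ ld) (sym (suc-injective (∷-injectiveˡ (trans e (ψs-image-ends-interval eq h)))))
q-other-image≢s-image {σ1} {σs} {t} {t'} {y ∷ pre} ni ns ld eq (inj₁ h) e
  with map≡++⁻ (bump (suc t)) (map (bump (suc t')) pre) (interval 0 (suc t')) (∷-injectiveʳ (trans e (ψs-image-ends-interval eq h)))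
... | A , B , eσ , _ , eB = ns 0 (suc t') (s≤s z≤n) (A , s≤s z≤n , trans eσ (cong (A ++_) (trans Be (sym (map-+-oneTo 0 (suc t'))))))
  where
  lt' : suc t' < suc t
  lt' with suc t ≤? suc t'
  ... | no g = ≰⇒> g
  ... | yes g with ∈-map⁻ (bump (suc t)) (subst (suc t ∈_) (sym eB) (∈-interval⁺ 0 (suc t') (s≤s z≤n) g))
  ... | x , _ , ex = ⊥-elim (bump-≢ (suc t) x (sym ex))
  Be : B ≡ interval 0 (suc t')
  Be = trans (sym (map-unbump-bump (suc t) B)) (trans (cong (map (unbump (suc t))) eB)
         (map-unbump-≤ (suc t) (interval 0 (suc t')) (All.tabulate (λ mm → ≤-trans (proj₂ (∈-interval⁻ 0 (suc t') mm)) (<⇒≤ lt')))))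

r-image≢s-image : ∀ {σ1 σs t pre} → 1 ≤ length σ1 → σs ≡ pre ++ oneTo t → (1 ≤ t ⊎ σs ≡ []) →
  map suc σ1 ++ [ 1 ] ≡ map (bump (suc t)) σs ++ [ suc t ] → ⊥
r-image≢s-image {σ1} {t = t} {pre} l eq (inj₂ refl) e with ψs-domain-[] {[]} {t} {pre} eq refl
... | refl with map≡[] suc (∷ʳ-injectiveˡ (map suc σ1) [] e)
... | refl with l
... | ()
r-image≢s-image {σ1} {σs} l eq (inj₁ h) e = <⇒≢ h (suc-injective (∷ʳ-injectiveʳ (map suc σ1) _ e))

interval-prefix-longer : ∀ a d X Y → interval 0 (suc a) ++ X ≡ interval 0 (suc (suc a + d)) ++ Y → X ≡ interval (suc a) (suc d) ++ Y
interval-prefix-longer a d X Y e = ++-cancelˡ (interval 0 (suc a)) X _ (trans e (trans (cong (_++ Y) rr) (++-assoc (interval 0 (suc a)) _ Y)))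
  where
  rr : interval 0 (suc (suc a + d)) ≡ interval 0 (suc a) ++ interval (suc a) (suc d)
  rr = trans (cong (interval 0) (sym (+-suc (suc a) d))) (interval-++ 0 (suc a) (suc d))

q-sandwiched-image-a-injective : ∀ {σ1 a b m ms a' b' mid'} → IsPerm σ1 → SandwichedWith σ1 a (suc b) (m ∷ ms) → a < a' →
  interval 0 (suc a) ++ map suc (m ∷ ms) ++ interval (suc a) b ≡ interval 0 (suc a') ++ map suc mid' ++ interval (suc a') b' → ⊥
q-sandwiched-image-a-injective {σ1} {a} {b} {m} {ms} {a'} {b'} {mid'} hp sw lt e =
  sandwich-middle-head hp sw (suc-injective (∷-injectiveˡ (interval-prefix-longer a (a' ∸ suc a) _ _ (subst (λ z → interval 0 (suc a) ++ map suc (m ∷ ms) ++ interval (suc a) b ≡ interval 0 (suc z) ++ map suc mid' ++ interval (suc a') b') (sym (m+[n∸m]≡n lt)) e))))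

q-sandwiched-image-injective : ∀ {σ1 σ2 a b mid a' b' mid'} → EAPerm σ1 → ¬ IsIdentity σ1 → SandwichedWith σ1 a b mid →
  EAPerm σ2 → ¬ IsIdentity σ2 → SandwichedWith σ2 a' b' mid' → ψq-sandwiched a b mid ≡ ψq-sandwiched a' b' mid' → σ1 ≡ σ2
q-sandwiched-image-injective {b = zero} h1 n1 (() , _) h2 n2 sw2 e
q-sandwiched-image-injective {b' = zero} h1 n1 sw1 h2 n2 (() , _) e
q-sandwiched-image-injective {σ1} {σ2} {a} {suc b} {mid} {a'} {suc b'} {mid'} h1 n1 sw1 h2 n2 sw2 e with <-cmp a a'
... | tri< lt _ _ = ⊥-elim (refute-with-middle mid refl sw1)
  where
  refute-with-middle : ∀ md → md ≡ mid → SandwichedWith σ1 a (suc b) md → ⊥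
  refute-with-middle [] refl sw = sandwich-middle-nonempty {σ1} {a} {suc b} {[]} n1 sw refl
  refute-with-middle (m ∷ ms) refl sw = q-sandwiched-image-a-injective {σ1} {a} {b} {m} {ms} {a'} {b'} {mid'} (proj₁ h1) sw lt
     (∷-injectiveʳ (trans (sym (ψq-sandwiched-intervals a b mid)) (trans e (ψq-sandwiched-intervals a' b' mid'))))
... | tri> _ _ gt = ⊥-elim (refute-with-middle mid' refl sw2)
  where
  refute-with-middle : ∀ md → md ≡ mid' → SandwichedWith σ2 a' (suc b') md → ⊥
  refute-with-middle [] refl sw = sandwich-middle-nonempty {σ2} {a'} {suc b'} {[]} n2 sw refl
  refute-with-middle (m ∷ ms) refl sw = q-sandwiched-image-a-injective {σ2} {a'} {b'} {m} {ms} {a} {b} {mid} (proj₁ h2) sw gt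
     (∷-injectiveʳ (trans (sym (ψq-sandwiched-intervals a' b' mid')) (trans (sym e) (ψq-sandwiched-intervals a b mid))))
... | tri≈ _ refl _ with suc-injective (+-cancelˡ-≡ a _ _ (suc-injective (∷-injectiveˡ e')))
  where
  e' : suc (a + suc b) ∷ interval 0 (suc a) ++ map suc mid ++ interval (suc a) b
     ≡ suc (a + suc b') ∷ interval 0 (suc a) ++ map suc mid' ++ interval (suc a) b'
  e' = trans (sym (ψq-sandwiched-intervals a b mid)) (trans e (ψq-sandwiched-intervals a b' mid'))
... | refl = trans (SandwichedWith⇒intervals {σ1} {a} {suc b} {mid} sw1) (trans (cong (λ u → interval 0 a ++ u ++ interval a (suc b)) me) (sym (SandwichedWith⇒intervals {σ2} {a} {suc b} {mid'} sw2)))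
  where
  e' : suc (a + suc b) ∷ interval 0 (suc a) ++ map suc mid ++ interval (suc a) b
     ≡ suc (a + suc b) ∷ interval 0 (suc a) ++ map suc mid' ++ interval (suc a) b
  e' = trans (sym (ψq-sandwiched-intervals a b mid)) (trans e (ψq-sandwiched-intervals a b mid'))
  me : mid ≡ mid'
  me = map-injective suc-injective (++-cancelʳ (interval (suc a) b) (map suc mid) (map suc mid')
         (++-cancelˡ (interval 0 (suc a)) _ _ (∷-injectiveʳ e')))

q-other-image-injective : ∀ {σ1 σ2 t t'} → suc t ∷ map (bump (suc t)) σ1 ≡ suc t' ∷ map (bump (suc t')) σ2 → σ1 ≡ σ2
q-other-image-injective {t = t} e with suc-injective (∷-injectiveˡ e)
... | refl = map-injective (bump-injective (suc t)) (∷-injectiveʳ e)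

r-image-injective : ∀ {σ1 σ2} → map suc σ1 ++ [ 1 ] ≡ map suc σ2 ++ [ 1 ] → σ1 ≡ σ2
r-image-injective {σ1} {σ2} e = map-injective suc-injective (∷ʳ-injectiveˡ (map suc σ1) (map suc σ2) e)

s-image-injective : ∀ {σ1 σ2 t t'} → map (bump (suc t)) σ1 ++ [ suc t ] ≡ map (bump (suc t')) σ2 ++ [ suc t' ] → σ1 ≡ σ2
s-image-injective {σ1} {σ2} {t} {t'} e with ∷ʳ-injectiveʳ (map (bump (suc t)) σ1) (map (bump (suc t')) σ2) e
... | refl = map-injective (bump-injective (suc t)) (∷ʳ-injectiveˡ (map (bump (suc t)) σ1) (map (bump (suc t)) σ2) e)

StepShape-deterministic : ∀ {c c' σ σ' π} → StepShape c σ π → StepShape c' σ' π → c ≡ c' × σ ≡ σ'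
StepShape-deterministic (shape-p h1 n1 e1) (shape-p h2 n2 e2) = refl , map-injective suc-injective (∷-injectiveʳ (trans (sym e1) e2))
StepShape-deterministic (shape-p h1 n1 e1) (shape-q-sand h2 n2 sw e2) = ⊥-elim (p-image≢q-sandwiched-image (proj₁ sw) (trans (sym e1) e2))
StepShape-deterministic (shape-p h1 n1 e1) (shape-q-other h2 n2 ns ld e2) = ⊥-elim (p-image≢q-other-image (proj₁ ld) (trans (sym e1) e2))
StepShape-deterministic (shape-p h1 n1 e1) (shape-r h2 l e2) = ⊥-elim (p-image≢r-image h2 l (trans (sym e1) e2))
StepShape-deterministic (shape-p h1 n1 e1) (shape-s h2 eq d e2) = ⊥-elim (p-image≢s-image n1 h2 eq d (trans (sym e1) e2))
StepShape-deterministic (shape-q-sand h2 n2 sw e2) (shape-p h1 n1 e1) = ⊥-elim (p-image≢q-sandwiched-image (proj₁ sw) (trans (sym e1) e2))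
StepShape-deterministic (shape-q-other h2 n2 ns ld e2) (shape-p h1 n1 e1) = ⊥-elim (p-image≢q-other-image (proj₁ ld) (trans (sym e1) e2))
StepShape-deterministic (shape-r h2 l e2) (shape-p h1 n1 e1) = ⊥-elim (p-image≢r-image h2 l (trans (sym e1) e2))
StepShape-deterministic (shape-s h2 eq d e2) (shape-p h1 n1 e1) = ⊥-elim (p-image≢s-image n1 h2 eq d (trans (sym e1) e2))
StepShape-deterministic (shape-q-sand h1 n1 sw1 e1) (shape-q-sand h2 n2 sw2 e2) = refl , q-sandwiched-image-injective h1 n1 sw1 h2 n2 sw2 (trans (sym e1) e2)
StepShape-deterministic (shape-q-sand h1 n1 sw1 e1) (shape-q-other h2 n2 ns ld e2) = ⊥-elim (q-sandwiched-image≢q-other-image h1 n1 sw1 h2 ns ld (trans (sym e1) e2))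
StepShape-deterministic (shape-q-other h2 n2 ns ld e2) (shape-q-sand h1 n1 sw1 e1) = ⊥-elim (q-sandwiched-image≢q-other-image h1 n1 sw1 h2 ns ld (trans (sym e1) e2))
StepShape-deterministic (shape-q-sand h1 n1 sw1 e1) (shape-r h2 l e2) = ⊥-elim (q-sandwiched-image≢r-image h1 n1 sw1 (trans (sym e1) e2))
StepShape-deterministic (shape-r h2 l e2) (shape-q-sand h1 n1 sw1 e1) = ⊥-elim (q-sandwiched-image≢r-image h1 n1 sw1 (trans (sym e1) e2))
StepShape-deterministic (shape-q-sand h1 n1 sw1 e1) (shape-s h2 eq d e2) = ⊥-elim (q-sandwiched-image≢s-image h1 n1 sw1 h2 eq d (trans (sym e1) e2))
StepShape-deterministic (shape-s h2 eq d e2) (shape-q-sand h1 n1 sw1 e1) = ⊥-elim (q-sandwiched-image≢s-image h1 n1 sw1 h2 eq d (trans (sym e1) e2))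
StepShape-deterministic (shape-q-other h1 n1 ns1 ld1 e1) (shape-q-other h2 n2 ns2 ld2 e2) = refl , q-other-image-injective (trans (sym e1) e2)
StepShape-deterministic (shape-q-other h1 n1 ns1 ld1 e1) (shape-r h2 l e2) = ⊥-elim (q-other-image≢r-image ns1 ld1 l (trans (sym e1) e2))
StepShape-deterministic (shape-r h2 l e2) (shape-q-other h1 n1 ns1 ld1 e1) = ⊥-elim (q-other-image≢r-image ns1 ld1 l (trans (sym e1) e2))
StepShape-deterministic (shape-q-other h1 n1 ns1 ld1 e1) (shape-s h2 eq d e2) = ⊥-elim (q-other-image≢s-image n1 ns1 ld1 eq d (trans (sym e1) e2))
StepShape-deterministic (shape-s h2 eq d e2) (shape-q-other h1 n1 ns1 ld1 e1) = ⊥-elim (q-other-image≢s-image n1 ns1 ld1 eq d (trans (sym e1) e2))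
StepShape-deterministic (shape-r h1 l1 e1) (shape-r h2 l2 e2) = refl , r-image-injective (trans (sym e1) e2)
StepShape-deterministic (shape-r h1 l1 e1) (shape-s h2 eq d e2) = ⊥-elim (r-image≢s-image l1 eq d (trans (sym e1) e2))
StepShape-deterministic (shape-s h2 eq d e2) (shape-r h1 l1 e1) = ⊥-elim (r-image≢s-image l1 eq d (trans (sym e1) e2))
StepShape-deterministic (shape-s h1 eq1 d1 e1) (shape-s h2 eq2 d2 e2) = refl , s-image-injective (trans (sym e1) e2)

∷ʳ≢[] : ∀ (xs : List ℕ) x → xs ++ [ x ] ≢ []
∷ʳ≢[] [] x ()
∷ʳ≢[] (_ ∷ _) x ()

Step-image≢[] : ∀ {c σ π} → Step c σ π → π ≢ []
Step-image≢[] st e with stepShape st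
... | shape-p _ _ e' with trans (sym e) e'
...   | ()
Step-image≢[] st e | shape-q-sand _ _ _ e' with trans (sym e) e'
...   | ()
Step-image≢[] st e | shape-q-other _ _ _ _ e' with trans (sym e) e'
...   | ()
Step-image≢[] st e | shape-r {σ = σ} _ _ e' = ∷ʳ≢[] (map suc σ) 1 (trans (sym e') e)
Step-image≢[] st e | shape-s {σ = σ} {t = t} _ _ _ e' = ∷ʳ≢[] (map (bump (suc t)) σ) (suc t) (trans (sym e') e)

Step-domain-EAPerm : ∀ {c σ π} → Step c σ π → EAPerm σ
Step-domain-EAPerm st with stepShape st
... | shape-p h _ _ = h
... | shape-q-sand h _ _ _ = h
... | shape-q-other h _ _ _ _ = h
... | shape-r h _ _ = h
... | shape-s h _ _ _ = h

Generates-unique : ∀ {w w' π} → Generates w π → Generates w' π → w' ≡ w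
Generates-unique gen-nil gen-nil = refl
Generates-unique gen-nil (gen-cons g st) = ⊥-elim (Step-image≢[] st refl)
Generates-unique (gen-cons g st) gen-nil = ⊥-elim (Step-image≢[] st refl)
Generates-unique (gen-cons g1 st1) (gen-cons g2 st2) with StepShape-deterministic (stepShape st1) (stepShape st2)
... | refl , refl = cong (_ ∷_) (Generates-unique g1 g2)

-- Existence of a last step

¬EvilPattern-a<b,c,d : ∀ {a b c d} → a < b → a < c → a < d → ¬ EvilPattern a b c d
¬EvilPattern-a<b,c,d ab ac ad (inj₁ (ca , _ , _)) = <-asym ac ca
¬EvilPattern-a<b,c,d ab ac ad (inj₂ (inj₁ (bd , dc , ca))) = <-asym ac ca
¬EvilPattern-a<b,c,d ab ac ad (inj₂ (inj₂ (inj₁ (cb , bd , da)))) = <-asym ad da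
¬EvilPattern-a<b,c,d ab ac ad (inj₂ (inj₂ (inj₂ (cb , ba , ad')))) = <-asym ab ba

¬EvilPattern-d<a,b,c : ∀ {a b c d} → d < a → d < b → d < c → ¬ EvilPattern a b c d
¬EvilPattern-d<a,b,c da db dc (inj₁ (ca , ad , db')) = <-asym da ad
¬EvilPattern-d<a,b,c da db dc (inj₂ (inj₁ (bd , dc' , ca))) = <-asym db bd
¬EvilPattern-d<a,b,c da db dc (inj₂ (inj₂ (inj₁ (cb , bd , da')))) = <-asym db bd
¬EvilPattern-d<a,b,c da db dc (inj₂ (inj₂ (inj₂ (cb , ba , ad)))) = <-asym da ad

¬EvilPattern-c<d<a,b : ∀ {a b c d} → c < d → d < a → d < b → ¬ EvilPattern a b c d
¬EvilPattern-c<d<a,b cd da db (inj₁ (ca , ad , db')) = <-asym da ad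
¬EvilPattern-c<d<a,b cd da db (inj₂ (inj₁ (bd , dc , ca))) = <-asym cd dc
¬EvilPattern-c<d<a,b cd da db (inj₂ (inj₂ (inj₁ (cb , bd , da')))) = <-asym db bd
¬EvilPattern-c<d<a,b cd da db (inj₂ (inj₂ (inj₂ (cb , ba , ad)))) = <-asym da ad

¬EvilPattern-b<c<d<a : ∀ {a b c d} → b < c → c < d → d < a → ¬ EvilPattern a b c d
¬EvilPattern-b<c<d<a bc cd da (inj₁ (ca , ad , db)) = <-asym da ad
¬EvilPattern-b<c<d<a bc cd da (inj₂ (inj₁ (bd , dc , ca))) = <-asym cd dc
¬EvilPattern-b<c<d<a bc cd da (inj₂ (inj₂ (inj₁ (cb , bd , da')))) = <-asym bc cb
¬EvilPattern-b<c<d<a bc cd da (inj₂ (inj₂ (inj₂ (cb , ba , ad)))) = <-asym bc cb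

¬EvilPattern-a<b<c<d : ∀ {a b c d} → a < b → b < c → c < d → ¬ EvilPattern a b c d
¬EvilPattern-a<b<c<d ab bc cd (inj₁ (ca , ad , db)) = <-asym (<-trans ab bc) ca
¬EvilPattern-a<b<c<d ab bc cd (inj₂ (inj₁ (bd , dc , ca))) = <-asym cd dc
¬EvilPattern-a<b<c<d ab bc cd (inj₂ (inj₂ (inj₁ (cb , bd , da)))) = <-asym bc cb
¬EvilPattern-a<b<c<d ab bc cd (inj₂ (inj₂ (inj₂ (cb , ba , ad)))) = <-asym bc cb

-- An occurrence starting in P starts with its minimum; one not meeting P either
-- lies in M or ends with k ≥ 1 entries of T, which increase and lie below the rest.
EvilFree-++-increasing-ends : ∀ P M T → AllPairs _<_ P → AllPairs _<_ T → (∀ {x y} → x ∈ P → y ∈ M ++ T → x < y) →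
  (∀ {x y} → x ∈ T → y ∈ M → x < y) → EvilFree M → EvilFree (P ++ M ++ T)
EvilFree-++-increasing-ends P M T iP iT cP cT eM {a} {b} {c} {d} h bad with ⊆-++⁻ P h
... | (x ∷ xs1) , xs2 , e , s1 , s2 with ∷-injective e
...   | refl , e' = ¬EvilPattern-a<b,c,d (All.lookup al (here refl)) (All.lookup al (there (here refl))) (All.lookup al (there (there (here refl)))) bad
  where
  al : All (a <_) (b ∷ c ∷ d ∷ [])
  al = subst (All (a <_)) (sym e') (AllP.++⁺ (AllPairs.head (AllPairs-⊆ s1 iP)) (All.tabulate (λ m → cP (Any-resp-⊆ s1 (here refl)) (Any-resp-⊆ s2 m))))
EvilFree-++-increasing-ends P M T iP iT cP cT eM {a} {b} {c} {d} h bad | [] , xs2 , refl , s1 , s2 with ⊆-++⁻ M s2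
... | ys1 , [] , e , t1 , t2 = eM (subst (_⊆ M) (sym (trans e (++-identityʳ ys1))) t1) bad
... | ys1 , (z ∷ zs) , e , t1 , t2 = cases ys1 e t1 t2
  where
  ltz : ∀ {x y} → x ∈ z ∷ zs → y ∈ M → x < y
  ltz mx my = cT (Any-resp-⊆ t2 mx) my
  iz : AllPairs _<_ (z ∷ zs)
  iz = AllPairs-⊆ t2 iT
  cases : ∀ ys → a ∷ b ∷ c ∷ d ∷ [] ≡ ys ++ z ∷ zs → ys ⊆ M → (z ∷ zs) ⊆ T → ⊥
  cases [] refl t1 t2 with iz
  ... | (ab ∷ ac ∷ ad ∷ []) ∷ (bc ∷ _) ∷ (cd ∷ []) ∷ _ = ¬EvilPattern-a<b<c<d ab bc cd bad
  cases (y1 ∷ []) refl t1 t2 with iz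
  ... | (bc ∷ bd ∷ []) ∷ (cd ∷ []) ∷ _ = ¬EvilPattern-b<c<d<a bc cd (ltz (there (there (here refl))) (Any-resp-⊆ t1 (here refl))) bad
  cases (y1 ∷ y2 ∷ []) refl t1 t2 with iz
  ... | (cd ∷ []) ∷ _ = ¬EvilPattern-c<d<a,b cd (ltz (there (here refl)) (Any-resp-⊆ t1 (here refl))) (ltz (there (here refl)) (Any-resp-⊆ t1 (there (here refl)))) bad
  cases (y1 ∷ y2 ∷ y3 ∷ []) refl t1 t2 = ¬EvilPattern-d<a,b,c (ltz (here refl) (Any-resp-⊆ t1 (here refl))) (ltz (here refl) (Any-resp-⊆ t1 (there (here refl)))) (ltz (here refl) (Any-resp-⊆ t1 (there (there (here refl))))) bad
  cases (y1 ∷ y2 ∷ y3 ∷ y4 ∷ ys) e t1 t2 with ∷-injectiveʳ (∷-injectiveʳ (∷-injectiveʳ (∷-injectiveʳ e)))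
  ... | e4 = nil-app ys e4
    where nil-app : ∀ (ys : List ℕ) → [] ≡ ys ++ z ∷ zs → ⊥
          nil-app [] ()
          nil-app (_ ∷ _) ()

Unique-++⁻ʳ : ∀ (A : List ℕ) {B} → Unique (A ++ B) → Unique B
Unique-++⁻ʳ A u = AllPairs-⊆ (++⁺ˡ A ⊆-refl) u

Unique-∷-∉ : ∀ A {k : ℕ} B → Unique (A ++ k ∷ B) → All (_≢ k) (A ++ B)
Unique-∷-∉ A {k} B u = All.tabulate f
  where
  f : ∀ {x} → x ∈ A ++ B → x ≢ k
  f {x} m refl with ∈-++⁻ A m
  ... | inj₁ ma = Unique-++-disjoint A u ma (here refl)
  ... | inj₂ mb = Unique-head∉ (Unique-++⁻ʳ A u) mb

take-length-++ : ∀ (A B : List ℕ) → take (length A) (A ++ B) ≡ A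
take-length-++ [] B = refl
take-length-++ (x ∷ A) B = cong (x ∷_) (take-length-++ A B)

drop-length-++ : ∀ (A B : List ℕ) → drop (length A) (A ++ B) ≡ B
drop-length-++ [] B = refl
drop-length-++ (x ∷ A) B = drop-length-++ A B

module Deletion {π} (A : List ℕ) (k : ℕ) (B : List ℕ) (π≡ : π ≡ A ++ k ∷ B) (hπ : EAPerm π) where

  σ : List ℕ
  σ = map (unbump k) (A ++ B)

  map-bump-σ : map (bump k) σ ≡ A ++ B
  map-bump-σ = map-bump-unbump k (A ++ B) (Unique-∷-∉ A B (subst Unique π≡ (IsPerm⇒Unique (proj₁ hπ))))

  π≡ρσ : π ≡ ρ k (suc (length A)) σ
  π≡ρσ = begin
    π                                                     ≡⟨ π≡ ⟩
    A ++ k ∷ B                                            ≡⟨ cong₂ (λ X Y → X ++ k ∷ Y) (take-length-++ A B) (drop-length-++ A B) ⟨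
    take (length A) (A ++ B) ++ k ∷ drop (length A) (A ++ B) ≡⟨ cong (λ Z → take (length A) Z ++ k ∷ drop (length A) Z) map-bump-σ ⟨
    ρ k (suc (length A)) σ                                ∎
    where open ≡-Reasoning

  π↭ : π ↭ k ∷ map (bump k) σ
  π↭ = ↭-trans (↭-reflexive π≡) (↭-trans (PP.shift k A B) (↭-reflexive (cong (k ∷_) (sym map-bump-σ))))

  σ-EAPerm : EAPerm σ
  σ-EAPerm = IsPerm-delete k σ (proj₁ hπ) π↭ , EvilFree⇒EvilAvoiding
    (EvilFree-map (bump k) (bump-mono-< k)
      (subst (_⊆ π) (sym map-bump-σ) (subst ((A ++ B) ⊆_) (sym π≡) (++⁺ ⊆-refl (_ ∷ʳ ⊆-refl))))
      (EvilAvoiding⇒EvilFree (proj₂ hπ)))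

  length-π : length π ≡ suc (length σ)
  length-π = trans (PP.↭-length π↭) (cong suc (length-map (bump k) σ))

EndsWithIdentity : List ℕ → Set
EndsWithIdentity π = ∃₂ λ X k → 1 ≤ k × π ≡ X ++ oneTo k

suffix? : (R Y : List ℕ) → Dec (∃ λ M → R ≡ M ++ Y)
suffix? [] [] = yes ([] , refl)
suffix? [] (y ∷ Y) = no (λ { ([] , ()) ; (m ∷ M , ()) })
suffix? (x ∷ R) Y with ≡-dec _≟_ (x ∷ R) Y
... | yes e = yes ([] , e)
... | no ne with suffix? R Y
...   | yes (M , e) = yes (x ∷ M , cong (x ∷_) e)
...   | no ne2 = no λ { ([] , e) → ne e ; (m ∷ M , e) → ne2 (M , ∷-injectiveʳ e) }

prefix? : (X τ : List ℕ) → Dec (∃ λ R → τ ≡ X ++ R)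
prefix? [] τ = yes (τ , refl)
prefix? (x ∷ X) [] = no (λ { (R , ()) })
prefix? (x ∷ X) (y ∷ τ) with y ≟ x | prefix? X τ
... | yes refl | yes (R , e) = yes (R , cong (x ∷_) e)
... | yes refl | no ne = no (λ (R , e) → ne (R , ∷-injectiveʳ e))
... | no ne | _ = no (λ (R , e) → ne (∷-injectiveˡ e))

endsWithIdentity? : ∀ π → IsPerm π → π ≢ [] → Dec (EndsWithIdentity π)
endsWithIdentity? π hp ne with ≢[]⇒∷ʳ π ne
... | I , z , eI with suffix? π (oneTo z)
...   | yes (M , e) = yes (M , z , All.lookup (IsPerm⇒positive hp) (subst (z ∈_) (sym eI) (∈-++⁺ʳ I (here refl))) , e)
...   | no nn = no f
  where
  f : EndsWithIdentity π → ⊥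
  f (X , suc k , h , e) = nn (X , subst (λ w → π ≡ X ++ oneTo w) kz e)
    where
    e2 : π ≡ (X ++ interval 0 k) ++ [ suc k ]
    e2 = trans e (trans (cong (X ++_) (trans (oneTo≡interval (suc k)) (interval-∷ʳ 0 k))) (sym (++-assoc X (interval 0 k) [ suc k ])))
    kz : suc k ≡ z
    kz = ∷ʳ-injectiveʳ (X ++ interval 0 k) I (trans (sym e2) eI)

length-oneTo : ∀ a → length (oneTo a) ≡ a
length-oneTo a = trans (cong length (oneTo≡interval a)) (length-interval 0 a)

sandwiched? : ∀ τ a b → Dec (Sandwiched τ a b)
sandwiched? τ a b with 1 ≤? b
... | no nb = no (λ (mid , h , _) → nb h)
... | yes hb with prefix? (oneTo a) τ
...   | no np = no (λ (mid , _ , e) → np (mid ++ map (a +_) (oneTo b) , e))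
...   | yes (R , eR) with suffix? R (map (a +_) (oneTo b))
...     | yes (M , eM) = yes (M , hb , trans eR (cong (oneTo a ++_) eM))
...     | no ns = no (λ (mid , _ , e) → ns (mid , ++-cancelˡ (oneTo a) R _ (trans (sym eR) e)))

search-down : (P : ℕ → Set) → (∀ k → Dec (P k)) → ∀ n → (∃ λ k → P k) ⊎ (∀ k → k ≤ n → ¬ P k)
search-down P d zero with d 0
... | yes h = inj₁ (0 , h)
... | no h = inj₂ (λ { zero _ → h ; (suc k) () })
search-down P d (suc n) with d (suc n)
... | yes h = inj₁ (suc n , h)
... | no h with search-down P d n
...   | inj₁ x = inj₁ x
...   | inj₂ f = inj₂ g
  where
  g : ∀ k → k ≤ suc n → ¬ P k
  g k le with k ≟ suc n
  ... | yes refl = h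
  ... | no kn = f k (≤-pred (≤∧≢⇒< le kn))

sandwiched-bounds : ∀ {τ a b} → Sandwiched τ a b → a ≤ length τ × b ≤ length τ
sandwiched-bounds {τ} {a} {b} (mid , _ , e) = ≤-trans (m≤m+n a _) (≤-reflexive (sym le)) , ≤-trans (≤-trans (m≤n+m b (length mid)) (m≤n+m _ a)) (≤-reflexive (sym le))
  where
  le : length τ ≡ a + (length mid + b)
  le = trans (cong length e) (trans (length-++ (oneTo a)) (cong₂ _+_ (length-oneTo a)
         (trans (length-++ mid) (cong (length mid +_) (trans (length-map (a +_) (oneTo b)) (length-oneTo b))))))

sandwiched-any? : ∀ τ → (∃₂ λ a b → Sandwiched τ a b) ⊎ (∀ a b → 1 ≤ b → ¬ Sandwiched τ a b)
sandwiched-any? τ with search-down (λ a → ∃ λ b → Sandwiched τ a b) dA (length τ)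
  where
  dA : ∀ a → Dec (∃ λ b → Sandwiched τ a b)
  dA a with search-down (Sandwiched τ a) (sandwiched? τ a) (length τ)
  ... | inj₁ (b , h) = yes (b , h)
  ... | inj₂ f = no (λ (b , h) → f b (proj₂ (sandwiched-bounds {τ} {a} {b} h)) h)
... | inj₁ (a , b , h) = inj₁ (a , b , h)
... | inj₂ f = inj₂ (λ a b _ h → f a (proj₁ (sandwiched-bounds {τ} {a} {b} h)) (b , h))

¬IsIdentity-middle : ∀ {σ a m ms Y} → σ ≡ interval 0 a ++ (m ∷ ms) ++ Y → m ≢ suc a → ¬ IsIdentity σ
¬IsIdentity-middle {σ} {a} {m} {ms} {Y} e ne idσ = ne (head-interval (interval-prefix 0 a (length σ) (m ∷ ms ++ Y) (trans (sym e) (IsIdentity⇒interval idσ))))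

module PermutationTail {v rest} (hπ : IsPerm (v ∷ rest)) where

  rest-Unique : Unique rest
  rest-Unique = AllPairs.tail (IsPerm⇒Unique hπ)

  ∈rest⇒≢head : ∀ {u} → u ∈ rest → u ≢ v
  ∈rest⇒≢head u∈ refl = All.lookup (AllPairs.head (IsPerm⇒Unique hπ)) u∈ refl

  ∈rest⇒positive : ∀ {u} → u ∈ rest → 0 < u
  ∈rest⇒positive u∈ = All.lookup (IsPerm⇒positive hπ) (there u∈)

  ∈rest⇒≤length : ∀ {u} → u ∈ rest → u ≤ suc (length rest)
  ∈rest⇒≤length u∈ = proj₂ (IsPerm-∈⁻ hπ (there u∈))

  ∈rest⁺ : ∀ {u} → 0 < u → u ≤ suc (length rest) → u ≢ v → u ∈ rest
  ∈rest⁺ 0<u u≤ u≢v with IsPerm-∈⁺ hπ 0<u u≤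
  ... | here u≡v = ⊥-elim (u≢v u≡v)
  ... | there u∈ = u∈

-- If the values below the first entry v were not in increasing order, the last
-- entry z of π would have to be below v, and the patterns 3214, 4132, 4213 through
-- v, 1 and z force the part of π after 1 to be exactly 2, …, z.
module SmallValuesIncreasing {v rest} (hπ : EAPerm (v ∷ rest)) (ne : ¬ EndsWithIdentity (v ∷ rest))
  {x y} (x<y : x < y) (y<v : y < v) (yx⊆ : (y ∷ x ∷ []) ⊆ rest)
  (I : List ℕ) (z : ℕ) (rest≡ : rest ≡ I ++ [ z ]) where

  open PermutationTail (proj₁ hπ)

  evil : ∀ {a b c d} → (a ∷ b ∷ c ∷ d ∷ []) ⊆ v ∷ rest → ¬ EvilPattern a b c d
  evil = EvilAvoiding⇒EvilFree (proj₂ hπ)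

  y∈ : y ∈ rest
  y∈ = Any-resp-⊆ yx⊆ (here refl)

  x∈ : x ∈ rest
  x∈ = Any-resp-⊆ yx⊆ (there (here refl))

  z∈ : z ∈ rest
  z∈ = subst (z ∈_) (sym rest≡) (∈-++⁺ʳ I (here refl))

  before-last : ∀ {u} → u ∈ rest → u ≢ z → (u ∷ z ∷ []) ⊆ rest
  before-last {u} u∈ u≢z with ∈-++⁻ I (subst (u ∈_) rest≡ u∈)
  ... | inj₁ u∈I = subst ((u ∷ z ∷ []) ⊆_) (sym rest≡) (++⁺ (from∈ u∈I) ⊆-refl)
  ... | inj₂ (here u≡z) = ⊥-elim (u≢z u≡z)

  z≢1 : z ≢ 1
  z≢1 refl = ne (v ∷ I , 1 , s≤s z≤n , cong (v ∷_) rest≡)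

  z<v : z < v
  z<v with <-cmp z v
  ... | tri< z<v _ _ = z<v
  ... | tri≈ _ z≡v _ = ⊥-elim (∈rest⇒≢head z∈ z≡v)
  ... | tri> _ _ v<z = ⊥-elim (evil (refl ∷ ⊆-glue rest-Unique (y ∷ []) yx⊆ (before-last x∈ (<⇒≢ (<-trans (<-trans x<y y<v) v<z))))
                            (inj₂ (inj₂ (inj₂ (x<y , y<v , v<z)))))

  1<z : 1 < z
  1<z = ≤∧≢⇒< (∈rest⇒positive z∈) (≢-sym z≢1)

  1∈ : 1 ∈ rest
  1∈ = ∈rest⁺ (s≤s z≤n) (s≤s z≤n) (<⇒≢ (≤-trans (s≤s (∈rest⇒positive x∈)) (<-trans x<y y<v)))

  module AroundOne (S T : List ℕ) (rest≡S1T : rest ≡ S ++ 1 ∷ T) where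

    ∈T⇒∈rest : ∀ {u} → u ∈ T → u ∈ rest
    ∈T⇒∈rest u∈ = subst (_ ∈_) (sym rest≡S1T) (∈-++⁺ʳ S (there u∈))

    1-before : ∀ {u} → u ∈ T → (1 ∷ u ∷ []) ⊆ rest
    1-before u∈ = subst (_ ⊆_) (sym rest≡S1T) (++⁺ˡ S (refl ∷ from∈ u∈))

    1-after : ∀ {u} → u ∈ S → (u ∷ 1 ∷ []) ⊆ rest
    1-after u∈ = subst (_ ⊆_) (sym rest≡S1T) (++⁺ (from∈ u∈) (refl ∷ minimum T))

    ∈rest-around-1 : ∀ {u} → u ∈ rest → u ∈ S ⊎ u ≡ 1 ⊎ u ∈ T
    ∈rest-around-1 u∈ with ∈-++⁻ S (subst (_ ∈_) rest≡S1T u∈)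
    ... | inj₁ u∈S = inj₁ u∈S
    ... | inj₂ (here u≡1) = inj₂ (inj₁ u≡1)
    ... | inj₂ (there u∈T) = inj₂ (inj₂ u∈T)

    T-Unique : Unique T
    T-Unique = Unique-++⁻ʳ (S ++ [ 1 ]) (subst Unique (trans rest≡S1T (sym (++-assoc S [ 1 ] T))) rest-Unique)

    ∈T⇒1< : ∀ {u} → u ∈ T → 1 < u
    ∈T⇒1< u∈ = ≤∧≢⇒< (∈rest⇒positive (∈T⇒∈rest u∈))
      (λ { refl → Unique-head∉ (Unique-++⁻ʳ S (subst Unique rest≡S1T rest-Unique)) u∈ })

    ∈T⇒≤z : ∀ {u} → u ∈ T → u ≤ z
    ∈T⇒≤z {u} u∈ with u ≤? z
    ... | yes u≤z = u≤z
    ... | no u≰z with <-cmp u v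
    ...   | tri≈ _ u≡v _ = ⊥-elim (∈rest⇒≢head (∈T⇒∈rest u∈) u≡v)
    ...   | tri< u<v _ _ =
            ⊥-elim (evil (refl ∷ ⊆-glue rest-Unique (1 ∷ []) (1-before u∈) (before-last (∈T⇒∈rest u∈) (u≰z ∘ ≤-reflexive)))
                         (inj₂ (inj₁ (1<z , ≰⇒> u≰z , u<v))))
    ...   | tri> _ _ v<u with ∈rest-around-1 y∈
    ...     | inj₁ y∈S = ⊥-elim (evil (refl ∷ ⊆-glue rest-Unique (y ∷ []) (1-after y∈S) (1-before u∈))
                                      (inj₂ (inj₂ (inj₂ (≤-<-trans (∈rest⇒positive x∈) x<y , y<v , v<u)))))
    ...     | inj₂ (inj₁ y≡1) = ⊥-elim (<⇒≢ (≤-<-trans (∈rest⇒positive x∈) x<y) (sym y≡1))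
    ...     | inj₂ (inj₂ y∈T) = ⊥-elim (evil (refl ∷ ⊆-glue rest-Unique (1 ∷ []) (1-before y∈T) yx⊆)
                                             (inj₂ (inj₁ (1<x , x<y , y<v))))
      where
      1<x : 1 < x
      1<x = ≤∧≢⇒< (∈rest⇒positive x∈)
        (λ { refl → ⊆-pair-antisym rest-Unique yx⊆ (1-before y∈T) })

    T-increasing : AllPairs _<_ T
    T-increasing = increasing-unless-inverted T-Unique inverted
      where
      inverted : ∀ {a b} → b < a → (a ∷ b ∷ []) ⊆ T → ⊥
      inverted b<a ab⊆ = evil (refl ∷ subst (_ ⊆_) (sym rest≡S1T) (++⁺ˡ S (refl ∷ ab⊆)))
        (inj₂ (inj₁ (∈T⇒1< (Any-resp-⊆ ab⊆ (there (here refl))) , b<a ,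
                      ≤-<-trans (∈T⇒≤z (Any-resp-⊆ ab⊆ (here refl))) z<v)))

    ∉S : ∀ {u} → 1 < u → u ≤ z → u ∈ S → ⊥
    ∉S {u} 1<u u≤z u∈S with u ≟ z
    ... | yes refl = ⊆-pair-antisym rest-Unique (1-after u∈S) (before-last 1∈ (≢-sym z≢1))
    ... | no u≢z = evil (refl ∷ ⊆-glue rest-Unique (u ∷ []) (1-after u∈S) (before-last 1∈ (≢-sym z≢1)))
                        (inj₂ (inj₂ (inj₁ (1<u , ≤∧≢⇒< u≤z u≢z , z<v))))

    ∈T⁺ : ∀ {u} → 1 < u → u ≤ z → u ∈ T
    ∈T⁺ {u} 1<u u≤z with ∈rest-around-1 (∈rest⁺ (<-trans z<s 1<u) (≤-trans u≤z (∈rest⇒≤length z∈)) (<⇒≢ (≤-<-trans u≤z z<v)))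
    ... | inj₁ u∈S = ⊥-elim (∉S 1<u u≤z u∈S)
    ... | inj₂ (inj₁ u≡1) = ⊥-elim (>⇒≢ 1<u u≡1)
    ... | inj₂ (inj₂ u∈T) = u∈T

    impossible : ⊥
    impossible = ne (v ∷ S , z , ∈rest⇒positive z∈ , cong (v ∷_) (begin
      rest                        ≡⟨ rest≡S1T ⟩
      S ++ 1 ∷ T                  ≡⟨ cong (λ T′ → S ++ 1 ∷ T′) T≡ ⟩
      S ++ interval 0 (suc (pred z)) ≡⟨ cong (λ k → S ++ interval 0 k) z≡ ⟩
      S ++ interval 0 z           ≡⟨ cong (S ++_) (sym (oneTo≡interval z)) ⟩
      S ++ oneTo z                ∎))
      where
      open ≡-Reasoning
      z≡ : suc (pred z) ≡ z
      z≡ = suc-pred z {{>-nonZero (<-trans z<s 1<z)}}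
      T≡ : T ≡ interval 1 (pred z)
      T≡ = increasing≡interval 1 (pred z) T-increasing
             (λ u∈ → ∈T⇒1< u∈ , subst (_ ≤_) (sym z≡) (∈T⇒≤z u∈))
             (λ 1<u u≤ → ∈T⁺ 1<u (subst (_ ≤_) z≡ u≤))

  impossible : ⊥
  impossible with ∈-∃++ 1∈
  ... | S , T , rest≡S1T = AroundOne.impossible S T rest≡S1T

small-values-increasing : ∀ {v rest x y} → EAPerm (v ∷ rest) → ¬ EndsWithIdentity (v ∷ rest) →
  x < y → y < v → ¬ (y ∷ x ∷ []) ⊆ rest
small-values-increasing {rest = rest} hπ ne x<y y<v yx⊆ with ≢[]⇒∷ʳ rest (λ { refl → case yx⊆ of λ () })
... | I , z , rest≡ = SmallValuesIncreasing.impossible hπ ne x<y y<v yx⊆ I z rest≡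

⊆-pair-prefix : ∀ P {Q x y} → Unique (P ++ Q) → x ∈ P → (y ∷ x ∷ []) ⊆ (P ++ Q) → (y ∷ x ∷ []) ⊆ P
⊆-pair-prefix P {Q} u mx h with ⊆-++⁻ P h
... | [] , _ , refl , _ , s2 = ⊥-elim (Unique-++-disjoint P u mx (Any-resp-⊆ s2 (there (here refl))))
... | _ ∷ [] , _ , refl , _ , s2 = ⊥-elim (Unique-++-disjoint P u mx (Any-resp-⊆ s2 (here refl)))
... | _ ∷ _ ∷ [] , [] , refl , s1 , _ = s1
... | _ ∷ _ ∷ [] , _ ∷ _ , () , _ , _
... | _ ∷ _ ∷ _ ∷ _ , _ , () , _ , _

⊆-pair-suffix : ∀ P {Q x y} → Unique (P ++ Q) → y ∈ Q → (y ∷ x ∷ []) ⊆ (P ++ Q) → (y ∷ x ∷ []) ⊆ Q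
⊆-pair-suffix P {Q} u my h with ⊆-++⁻ P h
... | [] , _ , refl , _ , s2 = s2
... | z ∷ zs , _ , e , s1 , _ = ⊥-elim (Unique-++-disjoint P u (subst (_∈ P) (sym (∷-injectiveˡ e)) (Any-resp-⊆ s1 (here refl))) my)

unbump≡-below : ∀ {v y' y} → unbump v y' ≡ y → y < v → y' ≢ v → y' ≡ y
unbump≡-below {v} {y'} {y} e yv ne with y' ≤? v
... | yes h = trans (sym (unbump-≤ h)) e
... | no h = ⊥-elim (<⇒≱ yv (subst (v ≤_) (trans (sym (unbump-> (≰⇒> h))) e) (pred-mono-≤ (≰⇒> h))))

IsPerm-resp-↭ : ∀ {σ τ} → σ ↭ τ → IsPerm τ → IsPerm σ
IsPerm-resp-↭ {σ} {τ} h hp = ↭-trans h (subst (λ z → τ ↭ oneTo z) (sym (PP.↭-length h)) hp)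

EvilFree-sandwich : ∀ {σ} a b mid → σ ≡ interval 0 a ++ mid ++ interval a b → All (a + b <_) mid → EvilFree mid → EvilFree σ
EvilFree-sandwich {σ} a b mid e am em = subst EvilFree (sym e) (EvilFree-++-increasing-ends (interval 0 a) mid (interval a b) (interval-increasing 0 a) (interval-increasing a b) cP cT em)
  where
  cP : ∀ {x y} → x ∈ interval 0 a → y ∈ mid ++ interval a b → x < y
  cP {x} {y} mx my with ∈-++⁻ mid my
  ... | inj₁ mm = ≤-<-trans (proj₂ (∈-interval⁻ 0 a mx)) (≤-<-trans (m≤m+n a b) (All.lookup am mm))
  ... | inj₂ mr = ≤-<-trans (proj₂ (∈-interval⁻ 0 a mx)) (proj₁ (∈-interval⁻ a b mr))
  cT : ∀ {x y} → x ∈ interval a b → y ∈ mid → x < y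
  cT mx my = ≤-<-trans (proj₂ (∈-interval⁻ a b mx)) (All.lookup am my)

¬IsIdentity-sandwich : ∀ {σ a mid Y} → σ ≡ interval 0 a ++ mid ++ Y → mid ≢ [] → All (suc a <_) mid → ¬ IsIdentity σ
¬IsIdentity-sandwich {mid = []} e ne am = ⊥-elim (ne refl)
¬IsIdentity-sandwich {σ} {a} {m ∷ ms} {Y} e ne (h ∷ _) = ¬IsIdentity-middle {σ} {a} {m} {ms} {Y} e (λ eq → <-irrefl (sym eq) h)

map-bump-interval-< : ∀ k m j → m + j < k → map (bump k) (interval m j) ≡ interval m j
map-bump-interval-< k m j h = map-bump-< k (interval m j) (All.tabulate (λ mm → ≤-<-trans (proj₂ (∈-interval⁻ m j mm)) h))

Preimage : Letter → List ℕ → Set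
Preimage c π = Σ (List ℕ) λ σ → Step c σ π × length π ≡ suc (length σ)

q-sandwiched-preimage : ∀ {π} a b mid → EAPerm π → mid ≢ [] → All (suc (a + suc b) ≤_) mid →
  π ≡ suc (a + suc b) ∷ interval 0 (suc a) ++ map suc mid ++ interval (suc a) b → Preimage q π
q-sandwiched-preimage {π} a b mid hπ mne am eπ = σ' , subst (Step q σ') (sym (trans eπ (sym (ψq-sandwiched-intervals a b mid)))) st , lenπ
  where
  v : ℕ
  v = suc (a + suc b)
  σ' τ0 : List ℕ
  σ' = oneTo a ++ mid ++ map (a +_) (oneTo (suc b))
  σe : σ' ≡ interval 0 a ++ mid ++ interval a (suc b)
  σe = cong₂ (λ u w → u ++ mid ++ w) (oneTo≡interval a) (map-+-oneTo a (suc b))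
  τ0 = interval 0 (suc a) ++ mid ++ interval (suc a) b
  mb : map (bump v) τ0 ≡ interval 0 (suc a) ++ map suc mid ++ interval (suc a) b
  mb = trans (map-++ (bump v) (interval 0 (suc a)) _) (cong₂ _++_ (map-bump-interval-< v 0 (suc a) (s≤s (≤-trans (s≤s (m≤m+n a b)) (≤-reflexive (sym (+-suc a b))))))
         (trans (map-++ (bump v) mid _) (cong₂ _++_ (map-bump-≥ v mid am)
           (map-bump-interval-< v (suc a) b (s≤s (≤-reflexive (sym (+-suc a b))))))))
  eτ : π ≡ v ∷ map (bump v) τ0
  eτ = trans eπ (cong (v ∷_) (sym mb))
  pτ : IsPerm τ0
  pτ = IsPerm-delete v τ0 (proj₁ hπ) (↭-reflexive eτ)
  sw : σ' ↭ τ0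
  sw = ↭-trans (↭-reflexive σe) (↭-trans (PP.++⁺ˡ (interval 0 a) (PP.shift (suc a) mid (interval (suc a) b)))
         (↭-reflexive (trans (sym (++-assoc (interval 0 a) [ suc a ] _)) (cong (_++ mid ++ interval (suc a) b) (sym (interval-∷ʳ 0 a))))))
  ea : EvilAvoiding σ'
  ea = EvilFree⇒EvilAvoiding (EvilFree-sandwich a (suc b) mid σe am (EvilFree-map suc s≤s (subst (map suc mid ⊆_) (sym eπ) (_ ∷ʳ (++⁺ˡ (interval 0 (suc a)) (++⁺ʳ (interval (suc a) b) ⊆-refl)))) (EvilAvoiding⇒EvilFree (proj₂ hπ))))
  ni : ¬ IsIdentity σ'
  ni = ¬IsIdentity-sandwich σe mne (All.map (λ h → ≤-trans (s≤s (s≤s (m≤m+n a b))) (≤-trans (≤-reflexive (cong suc (sym (+-suc a b)))) h)) am)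
  st : Step q σ' (ψq-sandwiched a (suc b) mid)
  st = step-q-sand (IsPerm-resp-↭ sw pτ , ea) ni (s≤s z≤n , refl)
  lenπ : length π ≡ suc (length σ')
  lenπ = trans (cong length eτ) (cong suc (trans (length-map (bump v) τ0) (sym (PP.↭-length sw))))

-- The
-- values below v increase along π and v + 1 occurs in π; whether v + 1 comes
-- after or before w = v − 1 decides between a sandwiched preimage read off
-- directly and a preimage obtained by deleting v.
module QPreimage {a0 rest} (hπ : EAPerm (suc (suc a0) ∷ rest))
  (ne : ¬ EndsWithIdentity (suc (suc a0) ∷ rest)) where

  w v n : ℕ
  w = suc a0
  v = suc w
  n = length rest

  π : List ℕ
  π = v ∷ rest

  open PermutationTail (proj₁ hπ)

  evil : ∀ {a b c d} → (a ∷ b ∷ c ∷ d ∷ []) ⊆ π → ¬ EvilPattern a b c d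
  evil = EvilAvoiding⇒EvilFree (proj₂ hπ)

  no-small-inversion : ∀ {x y} → x < y → y < v → ¬ (y ∷ x ∷ []) ⊆ rest
  no-small-inversion = small-values-increasing hπ ne

  v≤ : v ≤ suc n
  v≤ = proj₂ (IsPerm-∈⁻ (proj₁ hπ) (here refl))

  w∈ : w ∈ rest
  w∈ = ∈rest⁺ (s≤s z≤n) (≤-trans (n≤1+n w) v≤) (<⇒≢ ≤-refl)

  v+1∈ : suc v ∈ rest
  v+1∈ with v ≤? n
  ... | yes v≤n = ∈rest⁺ (s≤s z≤n) (s≤s v≤n) (>⇒≢ ≤-refl)
  ... | no v≰n = ⊥-elim (ne (v ∷ [] , n , ≤-pred (≤-trans (s≤s (s≤s z≤n)) (≤-reflexive v≡)) , cong (v ∷_) (trans rest≡ (sym (oneTo≡interval n)))))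
    where
    v≡ : v ≡ suc n
    v≡ = ≤-antisym v≤ (≰⇒> v≰n)
    ∈rest⇒<v : ∀ {x} → x ∈ rest → x < v
    ∈rest⇒<v x∈ = ≤∧≢⇒< (≤-trans (∈rest⇒≤length x∈) (≤-reflexive (sym v≡))) (∈rest⇒≢head x∈)
    rest≡ : rest ≡ interval 0 n
    rest≡ = increasing≡interval 0 n
      (increasing-unless-inverted rest-Unique (λ b<a ab⊆ → no-small-inversion b<a (∈rest⇒<v (Any-resp-⊆ ab⊆ (here refl))) ab⊆))
      (λ x∈ → ∈rest⇒positive x∈ , ≤-pred (≤-trans (∈rest⇒<v x∈) (≤-reflexive v≡)))
      (λ 0<x x≤n → ∈rest⁺ 0<x (≤-trans x≤n (n≤1+n n)) (λ x≡v → <-irrefl (trans x≡v v≡) (s≤s x≤n)))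

  module V+1AfterW (A B : List ℕ) (rest≡ : rest ≡ A ++ w ∷ B) (v+1∈B : suc v ∈ B) where

    AwB-Unique : Unique (A ++ w ∷ B)
    AwB-Unique = subst Unique rest≡ rest-Unique

    ∈A⇒∈rest : ∀ {x} → x ∈ A → x ∈ rest
    ∈A⇒∈rest x∈ = subst (_ ∈_) (sym rest≡) (∈-++⁺ˡ x∈)

    ∈B⇒∈rest : ∀ {x} → x ∈ B → x ∈ rest
    ∈B⇒∈rest x∈ = subst (_ ∈_) (sym rest≡) (∈-++⁺ʳ A (there x∈))

    ∈A⇒<w : ∀ {x} → x ∈ A → x < w
    ∈A⇒<w {x} x∈ with <-cmp x v
    ... | tri≈ _ x≡v _ = ⊥-elim (∈rest⇒≢head (∈A⇒∈rest x∈) x≡v)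
    ... | tri< x<v _ _ = ≤∧≢⇒< (≤-pred x<v) (λ { refl → Unique-++-disjoint A AwB-Unique x∈ (here refl) })
    ... | tri> _ _ v<x with x ≟ suc v
    ...   | yes refl = ⊥-elim (Unique-++-disjoint A AwB-Unique x∈ (there v+1∈B))
    ...   | no x≢v+1 = ⊥-elim (evil (refl ∷ subst (_ ⊆_) (sym rest≡) (++⁺ (from∈ x∈) (refl ∷ from∈ v+1∈B)))
                                    (inj₁ (≤-refl , ≤-refl , ≤∧≢⇒< v<x (≢-sym x≢v+1))))

    ∈B⇒>v : ∀ {x} → x ∈ B → v < x
    ∈B⇒>v {x} x∈ with <-cmp x v
    ... | tri≈ _ x≡v _ = ⊥-elim (∈rest⇒≢head (∈B⇒∈rest x∈) x≡v)
    ... | tri> _ _ v<x = v<x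
    ... | tri< x<v _ _ with x ≟ w
    ...   | yes refl = ⊥-elim (Unique-head∉ (Unique-++⁻ʳ A AwB-Unique) x∈)
    ...   | no x≢w = ⊥-elim (no-small-inversion (≤∧≢⇒< (≤-pred x<v) x≢w) ≤-refl
                              (subst (_ ⊆_) (sym rest≡) (++⁺ˡ A (refl ∷ from∈ x∈))))

    A≡ : A ≡ interval 0 a0
    A≡ = increasing≡interval 0 a0
      (increasing-unless-inverted (AllPairs-⊆ (++⁺ʳ (w ∷ B) ⊆-refl) AwB-Unique)
        (λ b<a ab⊆ → no-small-inversion b<a (<-trans (∈A⇒<w (Any-resp-⊆ ab⊆ (here refl))) ≤-refl)
                                         (subst (_ ⊆_) (sym rest≡) (++⁺ʳ (w ∷ B) ab⊆))))
      (λ x∈ → ∈rest⇒positive (∈A⇒∈rest x∈) , ≤-pred (∈A⇒<w x∈))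
      ∈A⁺
      where
      ∈A⁺ : ∀ {u} → 0 < u → u ≤ 0 + a0 → u ∈ A
      ∈A⁺ {u} 0<u u≤a0 with ∈-++⁻ A (subst (u ∈_) rest≡
                              (∈rest⁺ 0<u (≤-trans u≤a0 (≤-trans (n≤1+n a0) (≤-trans (n≤1+n w) v≤)))
                                      (<⇒≢ (s≤s (≤-trans u≤a0 (n≤1+n a0))))))
      ... | inj₁ u∈A = u∈A
      ... | inj₂ (here u≡w) = ⊥-elim (<-irrefl u≡w (s≤s u≤a0))
      ... | inj₂ (there u∈B) = ⊥-elim (<-asym (∈B⇒>v u∈B) (s≤s (≤-trans u≤a0 (n≤1+n a0))))

    mid : List ℕ
    mid = map pred B

    map-suc-mid : map suc mid ≡ B
    map-suc-mid = map-suc-pred B (All.tabulate (λ x∈ → ∈rest⇒positive (∈B⇒∈rest x∈)))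

    preimage : Preimage q π
    preimage = q-sandwiched-preimage a0 0 mid hπ mid≢[] mid-above π≡
      where
      mid≢[] : mid ≢ []
      mid≢[] mid≡[] with subst (_ ∈_) (trans (sym map-suc-mid) (cong (map suc) mid≡[])) v+1∈B
      ... | ()
      mid-above : All (suc (a0 + 1) ≤_) mid
      mid-above = All.tabulate above
        where
        above : ∀ {x} → x ∈ mid → suc (a0 + 1) ≤ x
        above x∈ with ∈-map⁻ pred x∈
        ... | y , y∈ , refl = subst (_≤ pred y) (cong suc (sym (+-comm a0 1))) (pred-mono-< (∈B⇒>v y∈))
      π≡ : π ≡ suc (a0 + 1) ∷ interval 0 (suc a0) ++ map suc mid ++ interval (suc a0) 0
      π≡ = cong₂ _∷_ (cong suc (+-comm 1 a0)) (begin
        rest                             ≡⟨ rest≡ ⟩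
        A ++ w ∷ B                       ≡⟨ cong (_++ w ∷ B) A≡ ⟩
        interval 0 a0 ++ w ∷ B           ≡⟨ ∷ʳ-++ (interval 0 a0) w B ⟨
        (interval 0 a0 ++ [ w ]) ++ B     ≡⟨ cong₂ _++_ (interval-∷ʳ 0 a0) map-suc-mid ⟨
        interval 0 (suc a0) ++ map suc mid ≡⟨ cong (interval 0 (suc a0) ++_) (++-identityʳ (map suc mid)) ⟨
        interval 0 (suc a0) ++ map suc mid ++ [] ∎)
        where open ≡-Reasoning

  module V+1BeforeW (A B : List ℕ) (rest≡ : rest ≡ A ++ w ∷ B) (v+1∈A : suc v ∈ A) where

    τ : List ℕ
    τ = map (unbump v) rest

    open Deletion [] v rest refl hπ using (π≡ρσ; length-π) renaming (σ-EAPerm to τ-EAPerm)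

    π≡ρτ : π ≡ ρ v 1 τ
    π≡ρτ = π≡ρσ

    no-small-inversionτ : ∀ {x y} → x < y → y < v → ¬ (y ∷ x ∷ []) ⊆ τ
    no-small-inversionτ x<y y<v yx⊆ with ⊆-map⁻ (unbump v) yx⊆
    ... | y′ ∷ x′ ∷ [] , yx⊆′ , e with ∷-injective e
    ...   | e₁ , e₂ = no-small-inversion x<y y<v
            (subst₂ (λ a b → (a ∷ b ∷ []) ⊆ rest)
              (unbump≡-below e₁ y<v (∈rest⇒≢head (Any-resp-⊆ yx⊆′ (here refl))))
              (unbump≡-below (∷-injectiveˡ e₂) (<-trans x<y y<v) (∈rest⇒≢head (Any-resp-⊆ yx⊆′ (there (here refl)))))
              yx⊆′)

    vw⊆τ : (v ∷ w ∷ []) ⊆ τ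
    vw⊆τ = subst₂ (λ a b → (a ∷ b ∷ []) ⊆ τ) (unbump-> ≤-refl) (unbump-≤ (n≤1+n w))
      (map⁺ (unbump v) (subst (_ ⊆_) (sym rest≡) (++⁺ (from∈ v+1∈A) (refl ∷ minimum B))))

    other-preimage : (∀ a b → 1 ≤ b → ¬ Sandwiched τ a b) → Preimage q π
    other-preimage unsandwiched = τ , subst (Step q τ) (sym π≡ρτ) (step-q-other τ-EAPerm τ≢id unsandwiched least) , length-π
      where
      τ≢id : ¬ IsIdentity τ
      τ≢id τ≡id = <-asym (increasing-pair (subst (AllPairs _<_) (sym (IsIdentity⇒interval τ≡id)) (interval-increasing 0 _)) vw⊆τ) ≤-refl
      least : IsLeastDescentValue τ w
      least = s≤s z≤n , ⊆⇒OccursAfter vw⊆τ , (λ i _ i<w i-after → no-small-inversionτ ≤-refl (s≤s i<w) (OccursAfter⇒⊆ i-after))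

    -- τ = [1..a] ++ mid ++ [a+1..a+b]: the descent v, w of τ forces a + b = w
    -- and every entry of mid to exceed w, so that π = ψq of a sandwiched permutation.
    module SandwichedCase (a b : ℕ) (mid : List ℕ) (1≤b : 1 ≤ b) (τ≡ : τ ≡ interval 0 a ++ mid ++ interval a b) where

      τ′-Unique : Unique (interval 0 a ++ mid ++ interval a b)
      τ′-Unique = subst Unique τ≡ (IsPerm⇒Unique (proj₁ τ-EAPerm))

      vw⊆ : (v ∷ w ∷ []) ⊆ interval 0 a ++ mid ++ interval a b
      vw⊆ = subst (_ ⊆_) τ≡ vw⊆τ

      a<w : a < w
      a<w with w ≤? a
      ... | no w≰a = ≰⇒> w≰a
      ... | yes w≤a = ⊥-elim (<-asym (increasing-pair (interval-increasing 0 a)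
                               (⊆-pair-prefix (interval 0 a) τ′-Unique (∈-interval⁺ 0 a (s≤s z≤n) w≤a) vw⊆)) ≤-refl)

      a+b≤w : a + b ≤ w
      a+b≤w with a + b ≤? w
      ... | yes a+b≤w = a+b≤w
      ... | no a+b≰w = ⊥-elim (<-asym (increasing-pair (interval-increasing a b)
                         (⊆-pair-suffix (interval 0 a ++ mid) (subst Unique (sym (++-assoc (interval 0 a) mid _)) τ′-Unique)
                           (∈-interval⁺ a b (<-trans a<w ≤-refl) (≰⇒> a+b≰w))
                           (subst (_ ⊆_) (sym (++-assoc (interval 0 a) mid _)) vw⊆))) ≤-refl)

      ∈mid : ∀ {x} → x ∈ interval 0 a ++ mid ++ interval a b → a + b < x → x ∈ mid
      ∈mid {x} x∈ a+b<x with ∈-++⁻ (interval 0 a) x∈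
      ... | inj₁ x∈₁ = ⊥-elim (<-irrefl refl (≤-<-trans (proj₂ (∈-interval⁻ 0 a x∈₁)) (≤-<-trans (m≤m+n a b) a+b<x)))
      ... | inj₂ x∈₂ with ∈-++⁻ mid x∈₂
      ...   | inj₁ x∈mid = x∈mid
      ...   | inj₂ x∈₃ = ⊥-elim (<⇒≱ a+b<x (proj₂ (∈-interval⁻ a b x∈₃)))

      a<a+b : a < a + b
      a<a+b = subst (_≤ a + b) (+-comm a 1) (+-monoʳ-≤ a 1≤b)

      w≤a+b : w ≤ a + b
      w≤a+b with w ≤? a + b
      ... | yes w≤a+b = w≤a+b
      ... | no w≰a+b = ⊥-elim (no-small-inversionτ (≤-<-trans a<a+b (≰⇒> w≰a+b)) ≤-refl
                          (subst (_ ⊆_) (sym τ≡) (++⁺ˡ (interval 0 a) (++⁺ (from∈ w∈mid) (from∈ (∈-interval⁺ a b ≤-refl a<a+b))))))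
        where
        w∈mid : w ∈ mid
        w∈mid = ∈mid (Any-resp-⊆ vw⊆ (there (here refl))) (≰⇒> w≰a+b)

      a+b≡w : a + b ≡ w
      a+b≡w = ≤-antisym a+b≤w w≤a+b

      mid-above : All (a + b <_) mid
      mid-above = All.tabulate above
        where
        above : ∀ {y} → y ∈ mid → a + b < y
        above {y} y∈ with a + b <? y
        ... | yes a+b<y = a+b<y
        ... | no a+b≮y with a <? y
        ...   | no a≮y = ⊥-elim (Unique-++-disjoint (interval 0 a) τ′-Unique
                           (∈-interval⁺ 0 a (positive (∈-++⁺ʳ (interval 0 a) (∈-++⁺ˡ y∈))) (≮⇒≥ a≮y)) (∈-++⁺ˡ y∈))
          where
          positive : ∀ {x} → x ∈ interval 0 a ++ mid ++ interval a b → 0 < x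
          positive x∈ = All.lookup (IsPerm⇒positive (proj₁ τ-EAPerm)) (subst (_ ∈_) (sym τ≡) x∈)
        ...   | yes a<y = ⊥-elim (Unique-++-disjoint mid (Unique-++⁻ʳ (interval 0 a) τ′-Unique) y∈ (∈-interval⁺ a b a<y (≮⇒≥ a+b≮y)))

      mid≢[] : mid ≢ []
      mid≢[] mid≡[] with subst (v ∈_) mid≡[] (∈mid (Any-resp-⊆ vw⊆ (here refl)) (s≤s (≤-reflexive a+b≡w)))
      ... | ()

      π≡ : π ≡ v ∷ interval 0 a ++ map suc mid ++ interval a b
      π≡ = trans π≡ρτ (cong (v ∷_) (begin
        map (bump v) τ ≡⟨ cong (map (bump v)) τ≡ ⟩
        map (bump v) (interval 0 a ++ mid ++ interval a b)
          ≡⟨ map-++ (bump v) (interval 0 a) _ ⟩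
        map (bump v) (interval 0 a) ++ map (bump v) (mid ++ interval a b)
          ≡⟨ cong (map (bump v) (interval 0 a) ++_) (map-++ (bump v) mid _) ⟩
        map (bump v) (interval 0 a) ++ map (bump v) mid ++ map (bump v) (interval a b)
          ≡⟨ cong₂ _++_ (map-bump-interval-< v 0 a (≤-<-trans (≤-trans (m≤m+n a b) a+b≤w) ≤-refl))
               (cong₂ _++_ (map-bump-≥ v mid (All.map (≤-trans (s≤s (≤-reflexive (sym a+b≡w)))) mid-above))
                           (map-bump-interval-< v a b (s≤s a+b≤w))) ⟩
        interval 0 a ++ map suc mid ++ interval a b ∎))
        where open ≡-Reasoning

      preimage : Preimage q π
      preimage = from-a a π≡ a+b≡w mid-above
        where
        from-a : ∀ a′ → π ≡ v ∷ interval 0 a′ ++ map suc mid ++ interval a′ b → a′ + b ≡ w → All (a′ + b <_) mid → Preimage q π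
        from-a zero π≡′ b≡w _ = ⊥-elim (ne (v ∷ map suc mid , w , s≤s z≤n ,
          trans π≡′ (cong (λ k → v ∷ map suc mid ++ k) (trans (cong (interval 0) b≡w) (sym (oneTo≡interval w))))))
        from-a (suc a′) π≡′ a′+b≡w above = q-sandwiched-preimage a′ b mid hπ mid≢[]
          (All.map (≤-trans (≤-reflexive (cong suc (+-suc a′ b)))) above)
          (trans π≡′ (cong (_∷ interval 0 (suc a′) ++ map suc mid ++ interval (suc a′) b)
                           (cong suc (trans (sym a′+b≡w) (sym (+-suc a′ b))))))

    preimage : Preimage q π
    preimage with sandwiched-any? τ
    ... | inj₂ unsandwiched = other-preimage unsandwiched
    ... | inj₁ (a , b , mid , 1≤b , τ≡) =
      SandwichedCase.preimage a b mid 1≤b (trans τ≡ (cong₂ (λ u z → u ++ mid ++ z) (oneTo≡interval a) (map-+-oneTo a b)))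

  preimage : Preimage q π
  preimage with ∈-∃++ w∈
  ... | A , B , rest≡ with ∈-++⁻ A (subst (suc v ∈_) rest≡ v+1∈)
  ...   | inj₁ v+1∈A = V+1BeforeW.preimage A B rest≡ v+1∈A
  ...   | inj₂ (here v+1≡w) = ⊥-elim (<-irrefl (sym v+1≡w) (n≤1+n v))
  ...   | inj₂ (there v+1∈B) = V+1AfterW.preimage A B rest≡ v+1∈B

q-preimage : ∀ {v rest} → EAPerm (v ∷ rest) → ¬ EndsWithIdentity (v ∷ rest) → 2 ≤ v → Preimage q (v ∷ rest)
q-preimage {suc (suc _)} hπ ne (s≤s (s≤s z≤n)) = QPreimage.preimage hπ ne

oneTo-∷ʳ : ∀ n → oneTo (suc n) ≡ oneTo n ++ [ suc n ]
oneTo-∷ʳ n = trans (oneTo≡interval (suc n)) (trans (interval-∷ʳ 0 n) (cong (_++ [ suc n ]) (sym (oneTo≡interval n))))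

oneTo-< : ∀ n → All (_< suc n) (oneTo n)
oneTo-< n = All.tabulate (λ i∈ → s≤s (proj₂ (∈-interval⁻ 0 n (subst (_ ∈_) (oneTo≡interval n) i∈))))

identity-preimage : ∀ n → EAPerm (oneTo (suc n)) → Preimage s (oneTo (suc n))
identity-preimage n h = oneTo n , subst (Step s (oneTo n)) ρ≡ (step-s {t = n} {pre = []} hσ refl (domain n)) ,
  trans (length-oneTo (suc n)) (cong suc (sym (length-oneTo n)))
  where
  domain : ∀ n → 1 ≤ n ⊎ oneTo n ≡ []
  domain zero = inj₂ refl
  domain (suc _) = inj₁ (s≤s z≤n)
  hσ : EAPerm (oneTo n)
  hσ = ↭-reflexive (cong oneTo (sym (length-oneTo n))) ,
       EvilFree⇒EvilAvoiding (EvilFree-⊆ (subst (oneTo n ⊆_) (sym (oneTo-∷ʳ n)) (++⁺ʳ [ suc n ] ⊆-refl)) (EvilAvoiding⇒EvilFree (proj₂ h)))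
  ρ≡ : ρ (suc n) (suc (length (oneTo n))) (oneTo n) ≡ oneTo (suc n)
  ρ≡ = begin
    ρ (suc n) (suc (length (oneTo n))) (oneTo n) ≡⟨ ρ-at-end (suc n) (oneTo n) ⟩
    map (bump (suc n)) (oneTo n) ++ [ suc n ]   ≡⟨ cong (_++ [ suc n ]) (map-bump-< (suc n) (oneTo n) (oneTo-< n)) ⟩
    oneTo n ++ [ suc n ]                         ≡⟨ oneTo-∷ʳ n ⟨
    oneTo (suc n)                                ∎
    where open ≡-Reasoning

p-preimage : ∀ {rest} → EAPerm (1 ∷ rest) → ¬ IsIdentity (1 ∷ rest) → Preimage p (1 ∷ rest)
p-preimage {rest} hπ π≢id = σ , subst (Step p σ) (sym π≡ρσ) (step-p σ-EAPerm σ≢id) , length-π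
  where
  open Deletion [] 1 rest refl hπ
  σ≢id : ¬ IsIdentity σ
  σ≢id σ≡id = π≢id (begin
    1 ∷ rest                                    ≡⟨ π≡ρσ ⟩
    1 ∷ map (bump 1) σ                          ≡⟨ cong (λ X → 1 ∷ map (bump 1) X) (IsIdentity⇒interval σ≡id) ⟩
    1 ∷ map (bump 1) (interval 0 (length σ))    ≡⟨ cong (1 ∷_) (map-bump-≥ 1 _ (All.tabulate (λ i∈ → proj₁ (∈-interval⁻ 0 _ i∈)))) ⟩
    1 ∷ map suc (interval 0 (length σ))         ≡⟨ cong (1 ∷_) (map-suc-interval 0 _) ⟩
    interval 0 (suc (length σ))                 ≡⟨ oneTo≡interval _ ⟨
    oneTo (suc (length σ))                      ≡⟨ cong oneTo length-π ⟨
    oneTo (length (1 ∷ rest))                   ∎)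
    where open ≡-Reasoning

r-preimage : ∀ {π} X → EAPerm π → π ≡ X ++ [ 1 ] → ¬ IsIdentity π → Preimage r π
r-preimage {π} X hπ π≡ π≢id = σ , subst (Step r σ) (sym π≡ρ) (step-r σ-EAPerm (≤-trans X-nonempty (≤-reflexive (sym length-σ)))) , length-π
  where
  open Deletion X 1 [] π≡ hπ
  length-σ : length σ ≡ length X
  length-σ = trans (length-map (unbump 1) (X ++ [])) (cong length (++-identityʳ X))
  π≡ρ : π ≡ ρ 1 (suc (length σ)) σ
  π≡ρ = trans π≡ρσ (cong (λ k → ρ 1 (suc k) σ) (sym length-σ))
  X-nonempty : 1 ≤ length X
  X-nonempty = nonempty X π≡
    where
    nonempty : ∀ Y → π ≡ Y ++ [ 1 ] → 1 ≤ length Y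
    nonempty [] π≡[1] = ⊥-elim (π≢id (trans π≡[1] (cong (oneTo ∘ length) (sym π≡[1]))))
    nonempty (_ ∷ _) _ = s≤s z≤n

s-preimage : ∀ {π} X t → EAPerm π → π ≡ X ++ oneTo (suc (suc t)) → Preimage s π
s-preimage {π} X t hπ π≡ = σ , subst (Step s σ) (sym π≡ρ) (step-s σ-EAPerm σ≡ (inj₁ (s≤s z≤n))) , length-π
  where
  A : List ℕ
  A = X ++ oneTo (suc t)
  open Deletion A (suc (suc t)) [] (trans π≡ (trans (cong (X ++_) (oneTo-∷ʳ (suc t))) (sym (++-assoc X _ _)))) hπ
  π≡ρ : π ≡ ρ (suc (suc t)) (suc (length σ)) σ
  π≡ρ = trans π≡ρσ (cong (λ k → ρ (suc (suc t)) (suc k) σ)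
          (sym (trans (length-map (unbump (suc (suc t))) (A ++ [])) (cong length (++-identityʳ A)))))
  σ≡ : σ ≡ map (unbump (suc (suc t))) X ++ oneTo (suc t)
  σ≡ = begin
    map (unbump (suc (suc t))) (A ++ [])       ≡⟨ cong (map (unbump (suc (suc t)))) (++-identityʳ A) ⟩
    map (unbump (suc (suc t))) A               ≡⟨ map-++ (unbump (suc (suc t))) X (oneTo (suc t)) ⟩
    map (unbump (suc (suc t))) X ++ map (unbump (suc (suc t))) (oneTo (suc t))
      ≡⟨ cong (map (unbump (suc (suc t))) X ++_) (map-unbump-≤ (suc (suc t)) (oneTo (suc t)) (All.map (≤-trans (n≤1+n _)) (oneTo-< (suc t)))) ⟩
    map (unbump (suc (suc t))) X ++ oneTo (suc t) ∎
    where open ≡-Reasoning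

LastStep : List ℕ → Set
LastStep π = Σ Letter λ c → Preimage c π

lastStep : ∀ π → EAPerm π → π ≢ [] → LastStep π
lastStep [] _ π≢[] = ⊥-elim (π≢[] refl)
lastStep (x ∷ rest) hπ π≢[] with ≡-dec _≟_ (x ∷ rest) (oneTo (suc (length rest)))
... | yes π≡id = s , subst (Preimage s) (sym π≡id) (identity-preimage (length rest) (subst EAPerm π≡id hπ))
... | no π≢id with x ≟ 1
...   | yes refl = p , p-preimage hπ π≢id
...   | no x≢1 with endsWithIdentity? (x ∷ rest) (proj₁ hπ) π≢[]
...     | no ¬ends = q , q-preimage hπ ¬ends (≤∧≢⇒< (All.lookup (IsPerm⇒positive (proj₁ hπ)) (here refl)) (≢-sym x≢1))
...     | yes (X , suc zero , _ , π≡) = r , r-preimage X hπ π≡ π≢id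
...     | yes (X , suc (suc t) , _ , π≡) = s , s-preimage X t hπ π≡

generates : ∀ n π → length π ≡ n → EAPerm π → Σ (List Letter) λ w → Generates w π
generates zero [] _ _ = [] , gen-nil
generates (suc n) (x ∷ rest) length≡ hπ with lastStep (x ∷ rest) hπ (λ ())
... | c , σ , step , length-π with generates n σ (suc-injective (trans (sym length-π) length≡)) (Step-domain-EAPerm step)
...   | w , g = c ∷ w , gen-cons g step

mainTheorem9 : (π : List ℕ) → EAPerm π →
    Σ (List Letter) (λ w → Generates w π × ((w' : List Letter) → Generates w' π → w' ≡ w))
mainTheorem9 π hπ with generates (length π) π refl hπ
... | w , g = w , g , λ w′ g′ → Generates-unique g g′
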